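{- Let $s,t$ be coprime positive integers with $s>1$, and let $O$ be a level $t$ orbit (an orbit of the action $\chi_t$ of $\hat{\mathfrak{S}}_s$ on the set of $s$-cores). Let $\nu\in O$ be an element for which $\sum_{k\in\mathcal{Q}(\nu)}k^2$ is minimal. Then $p_\nu$ lies in $\mathcal{R}^s_t$, and $\nu$ is a $t$-core.
   Context: Partitions, rim hooks, $s$-cores and $t$-cores as usual; the beta-set of $\lambda$ is $\{\lambda_i-i:i\geqslant1\}$. For an $s$-core $\lambda$ and $i\in\{0,\dots,s-1\}$ let $a_i$ be the smallest integer $\equiv i\pmod s$ not in the beta-set; $\mathcal{Q}(\lambda)=\{a_0,\dots,a_{s-1}\}$. An $s$-set is a set of $s$ integers pairwise incongruent mod $s$ with sum $\binom s2$; $\lambda\mapsto\mathcal{Q}(\lambda)$ is a bijection from $s$-cores to $s$-sets. $p_\lambda\in\mathbb{R}^s$ is the point whose coordinates are the elements of $\mathcal{Q}(\lambda)$ in increasing order. The level $t$ rhomboid is $\mathcal{R}^s_t=\{p\in\mathbb{R}^s: p_1+\dots+p_s=\binom s2,\ 1\leqslant p_{i+1}-p_i\leqslant t \text{ for } i=1,\dots,s-1\}$. The affine symmetric group $\hat{\mathfrak{S}}_s$ has generators $\sigma_0,\dots,\sigma_{s-1}$ with relations $\sigma_i^2=1$; $\sigma_i\sigma_j=\sigma_j\sigma_i$ for $i\not\equiv j\pm1\pmod s$; $\sigma_i\sigma_j\sigma_i=\sigma_j\sigma_i\sigma_j$ for $i\equiv j+1\not\equiv j-1\pmod s$. The action $\chi_t$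 on $s$-sets: for an $s$-set $Q$ and $i$, let $x,y\in Q$ with $x\equiv(i-1)t$, $y\equiv it\pmod s$; $\chi_t(\sigma_i)(Q)$ replaces $x$ by $x+t$ and $y$ by $y-t$. This gives an action on $s$-cores via the bijection. -}

module Defs where

open import Data.Nat as ℕ using (ℕ; zero; suc; _∸_; NonZero)
open import Data.Nat.DivMod using (_mod_)
open import Data.Nat.Combinatorics using (_C_)
open import Data.Integer as ℤ using (ℤ; +_; _-_)
open import Data.Fin using (Fin; toℕ; _≟_)
open import Data.List using (List; []; _∷_; length; filter; foldr; map; tabulate)
open import Data.List.Relation.Unary.All using (All)
open import Data.List.Relation.Unary.Linked using (Linked)
open import Data.Product using (Σ; ∃; _×_)
open import Data.Empty using (⊥)
open import Relation.Nullary using (¬_; yes; no)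
open import Relation.Binary.PropositionalEquality using (_≡_; _≢_)
open import Data.Integer.Properties using (≤-decTotalOrder)
import Data.List.Sort

record Partition : Set where
  constructor mkPartition
  field
    parts      : List ℕ
    decreasing : Linked ℕ._≥_ parts
    positive   : All (ℕ._<_ 0) parts
open Partition public

-- part λ r = λ_{r+1}  (0-indexed rows; 0 beyond the length)
partAt : List ℕ → ℕ → ℕ
partAt []       _       = 0
partAt (x ∷ xs) zero    = x
partAt (x ∷ xs) (suc r) = partAt xs r

part : Partition → ℕ → ℕ
part λ′ r = partAt (parts λ′) r

-- conjugate part: λ'_{c+1} = number of rows of length > c
conj : Partition → ℕ → ℕ
conj λ′ c = length (filter (λ x → c ℕ.<? x) (parts λ′))

-- Young diagram cells (r , c), 0-indexed: c < λ_{r+1}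
InDiagram : Partition → ℕ → ℕ → Set
InDiagram λ′ r c = c ℕ.< part λ′ r

-- hook length of cell (r , c): arm + leg + 1
hookLength : Partition → ℕ → ℕ → ℕ
hookLength λ′ r c = ((part λ′ r ∸ suc c) ℕ.+ (conj λ′ c ∸ suc r)) ℕ.+ 1

-- λ is a t-core: it has no rim hook of length t, i.e. no hook of length t
IsCore : ℕ → Partition → Set
IsCore t λ′ = ∀ r c → InDiagram λ′ r c → hookLength λ′ r c ≢ t

-- Beta-set {λᵢ - i : i ≥ 1}

InBeta : Partition → ℤ → Set
InBeta λ′ z = ∃ λ (i : ℕ) → z ≡ (+ part λ′ i) - (+ suc i)

_≡[_]_ : ℤ → ℕ → ℤ → Set
x ≡[ s ] y = ∃ λ (k : ℤ) → x - y ≡ k ℤ.* (+ s)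

-- a is the smallest integer ≡ i (mod s) not in the beta-set of λ
-- (i.e. a = a_i, the element of 𝒬(λ) in residue class i)
IsQEntry : (s : ℕ) → Partition → Fin s → ℤ → Set
IsQEntry s λ′ i a =
  (a ≡[ s ] (+ toℕ i)) × ¬ InBeta λ′ a ×
  (∀ z → z ≡[ s ] (+ toℕ i) → z ℤ.< a → InBeta λ′ z)

-- q represents 𝒬(λ): q i = a_i for every residue i
IsQ : (s : ℕ) → Partition → (Fin s → ℤ) → Set
IsQ s λ′ q = ∀ i → IsQEntry s λ′ i (q i)

-- The action χ_t on s-sets.  An s-set is represented residue-wise:
-- q : Fin s → ℤ with q j the (unique) element ≡ j (mod s).

module _ (s : ℕ) .{{_ : NonZero s}} (t : ℕ) where

  -- σ_i : x ≡ (i-1)t ↦ x + t ,  y ≡ it ↦ y - t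
  -- (x + t ≡ it, y - t ≡ (i-1)t, so residue slots are exchanged)
  χσ : Fin s → (Fin s → ℤ) → (Fin s → ℤ)
  χσ i q j with j ≟ ((toℕ i ℕ.* t) mod s) | j ≟ (((toℕ i ℕ.+ (s ∸ 1)) ℕ.* t) mod s)
  ... | yes _ | _     = q (((toℕ i ℕ.+ (s ∸ 1)) ℕ.* t) mod s) ℤ.+ (+ t)
  ... | no _  | yes _ = q ((toℕ i ℕ.* t) mod s) - (+ t)
  ... | no _  | no _  = q j

  χ : List (Fin s) → (Fin s → ℤ) → (Fin s → ℤ)
  χ []       q = q
  χ (i ∷ w) q = χσ i (χ w q)

sumSq : (s : ℕ) → (Fin s → ℤ) → ℤ
sumSq s q = foldr ℤ._+_ (+ 0) (map (λ x → x ℤ.* x) (tabulate q))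

open Data.List.Sort ≤-decTotalOrder using (sort)

point : (s : ℕ) → (Fin s → ℤ) → List ℤ
point s q = sort (tabulate q)

InRhomboid : (s t : ℕ) → List ℤ → Set
InRhomboid s t p =
  (length p ≡ s) ×
  (foldr ℤ._+_ (+ 0) p ≡ + (s C 2)) ×
  Linked (λ a b → ((+ 1) ℤ.≤ (b - a)) × ((b - a) ℤ.≤ (+ t))) p

module Submission where

-- Write q = 𝒬(ν) as a vector indexed by the residues mod s.
-- (1) Hooks and the beta-set (HookGaps, DescribedBeta): a cell in row r has
--     hook length h iff βᵣ - h is a gap of the beta-set.  So the beta-set of
--     an s-core is {z : z < q_{z mod s}}, and a beta-set of this form has no
--     h-hook as soon as q is h-step-bounded: q_c ≤ q_d + h whenever c ≡ d + h.
-- (2) 𝒬 onto s-sets (BetaLists, RangeSums, CountBelow, SSets): counting the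
--     shifted beta numbers gives Σ q = C(s,2) for an s-core, and shows that
--     every s-set is 𝒬 of some s-core.
-- (3) The action (Generators, Minimality): σᵢ puts q(b i) + t into slot a i and
--     q(a i) - t into slot b i, changing Σ q² by 2t(q(b i) - q(a i) + t).  By (2)
--     the result is 𝒬 of an s-core in the orbit, so minimality and coprimality
--     of s, t make q t-step-bounded.
-- Finally, a t-step-bounded q describes a t-core by (1), and lies in the
-- rhomboid (Rhomboid): walking through the classes d, d+t, d+2t, …, which
-- visits every class, raises q by at most t per step.

open import Data.Nat using (ℕ; NonZero)
open import Defs

module IntegerFacts where

  open import Data.Nat as ℕ using (ℕ; suc; s≤s)
  open import Data.Integer as ℤ using (ℤ; +_; -[1+_]; _+_; _-_; -_; _≤_; _<_; 0ℤ; ∣_∣)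
  open import Data.Product using (_×_; _,_)
  import Data.Integer.Properties as ℤP
  open import Data.Integer.Tactic.RingSolver using (solve-∀)
  open import Relation.Binary.PropositionalEquality

  pos-diff-≡ : ∀ a b c d → a ℕ.+ d ≡ c ℕ.+ b → + a - + b ≡ + c - + d
  pos-diff-≡ a b c d e = begin
      + a - + b                         ≡⟨ shift (+ a) (+ b) (+ d) ⟩
      (+ a + + d) - (+ b + + d)         ≡⟨ cong (_- (+ b + + d)) lhs ⟩
      (+ c + + b) - (+ b + + d)         ≡⟨ unshift (+ c) (+ b) (+ d) ⟩
      + c - + d                         ∎
    where
      open ≡-Reasoning
      lhs : + a + + d ≡ + c + + b
      lhs = trans (sym (ℤP.pos-+ a d)) (trans (cong +_ e) (ℤP.pos-+ c b))
      shift : ∀ a b d → a - b ≡ (a + d) - (b + d)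
      shift = solve-∀
      unshift : ∀ c b d → (c + b) - (b + d) ≡ c - d
      unshift = solve-∀

  pos-diff-≡⁻ : ∀ a b c d → + a - + b ≡ + c - + d → a ℕ.+ d ≡ c ℕ.+ b
  pos-diff-≡⁻ a b c d e = ℤP.+-injective (begin
      + (a ℕ.+ d)                       ≡⟨ ℤP.pos-+ a d ⟩
      + a + + d                         ≡⟨ split (+ a) (+ b) (+ d) ⟩
      (+ a - + b) + (+ b + + d)         ≡⟨ cong (_+ (+ b + + d)) e ⟩
      (+ c - + d) + (+ b + + d)         ≡⟨ unsplit (+ c) (+ b) (+ d) ⟩
      + c + + b                         ≡⟨ sym (ℤP.pos-+ c b) ⟩
      + (c ℕ.+ b)                       ∎)
    where
      open ≡-Reasoning
      split : ∀ a b d → a + d ≡ (a - b) + (b + d)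
      split = solve-∀
      unsplit : ∀ c b d → (c - d) + (b + d) ≡ c + b
      unsplit = solve-∀

  pos-diff₂-≡ : ∀ a b e c d → a ℕ.+ d ≡ c ℕ.+ (b ℕ.+ e) → (+ a - + b) - + e ≡ + c - + d
  pos-diff₂-≡ a b e c d h =
    trans (trans (assoc (+ a) (+ b) (+ e)) (cong (λ w → + a - w) (sym (ℤP.pos-+ b e))))
          (pos-diff-≡ a (b ℕ.+ e) c d h)
    where assoc : ∀ a b e → (a - b) - e ≡ a - (b + e)
          assoc = solve-∀

  pos-diff₂-≡⁻ : ∀ a b e c d → (+ a - + b) - + e ≡ + c - + d → a ℕ.+ d ≡ c ℕ.+ (b ℕ.+ e)
  pos-diff₂-≡⁻ a b e c d h =
    pos-diff-≡⁻ a (b ℕ.+ e) c d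
      (trans (trans (cong (λ w → + a - w) (ℤP.pos-+ b e)) (sym (assoc (+ a) (+ b) (+ e)))) h)
    where assoc : ∀ a b e → (a - b) - e ≡ a - (b + e)
          assoc = solve-∀

  ≤-by-diff : ∀ {a b c d} → a ≤ b → b - a ≡ d - c → c ≤ d
  ≤-by-diff a≤b e = ℤP.0≤i-j⇒j≤i (subst (0ℤ ≤_) e (ℤP.i≤j⇒0≤j-i a≤b))

  <-by-diff : ∀ {a b c d} → a < b → b - a ≡ d - c → c < d
  <-by-diff {a} {b} {c} {d} a<b e =
    ℤP.suc[i]≤j⇒i<j (≤-by-diff (ℤP.i<j⇒suc[i]≤j a<b) (trans (step a b) (trans (cong (_- + 1) e) (sym (step c d)))))
    where step : ∀ a b → b - (+ 1 + a) ≡ (b - a) - + 1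
          step = solve-∀

  abs-bounds : ∀ x {m} → ∣ x ∣ ℕ.≤ m → - (+ m) ≤ x × x ≤ + m
  abs-bounds (+ k)    {m}     k≤m     = ℤP.neg-≤-pos , ℤ.+≤+ k≤m
  abs-bounds -[1+ k ] {suc m} (s≤s k≤m) = ℤ.-≤- k≤m , ℤ.-≤+


module Residues (s : ℕ) .{{_ : NonZero s}} where

  open import Data.Nat as ℕ using (ℕ; suc)
  open import Data.Nat.DivMod using (_mod_; _%_; _/_; m≡m%n+[m/n]*n; [m+kn]%n≡m%n; m<n⇒m%n≡m; m%n<n)
  open import Data.Integer using (ℤ; +_; -[1+_]; _+_; _*_; _-_; -_)
  import Data.Integer.Properties as ℤP
  import Data.Integer.DivMod as ℤD
  open import Data.Integer.Tactic.RingSolver using (solve-∀)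
  open import Data.Fin using (Fin; toℕ; fromℕ<)
  import Data.Fin.Properties as FP
  open import Data.Product using (_,_)
  open import Relation.Binary.PropositionalEquality

  -- A record wrapper around  x ≡[ s ] y  so that x and y are inferable.
  infix 4 _≈_
  record _≈_ (x y : ℤ) : Set where
    constructor ⟪_⟫
    field un : x ≡[ s ] y
  open _≈_ public

  ≈-refl : ∀ {x} → x ≈ x
  ≈-refl {x} = ⟪ + 0 , trans (ℤP.+-inverseʳ x) (sym (ℤP.*-zeroˡ (+ s))) ⟫

  ≈-sym : ∀ {x y} → x ≈ y → y ≈ x
  ≈-sym {x} {y} ⟪ k , e ⟫ = ⟪ - k , trans (flip x y) (trans (cong -_ e) (ℤP.neg-distribˡ-* k (+ s))) ⟫
    where flip : ∀ x y → y - x ≡ - (x - y)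
          flip = solve-∀

  ≈-trans : ∀ {x y z} → x ≈ y → y ≈ z → x ≈ z
  ≈-trans {x} {y} {z} ⟪ k , e ⟫ ⟪ l , f ⟫ =
    ⟪ k + l , trans (telescope x y z) (trans (cong₂ _+_ e f) (sym (ℤP.*-distribʳ-+ (+ s) k l))) ⟫
    where telescope : ∀ x y z → x - z ≡ (x - y) + (y - z)
          telescope = solve-∀

  ≈-+ : ∀ {a b c d} → a ≈ b → c ≈ d → a + c ≈ b + d
  ≈-+ {a} {b} {c} {d} ⟪ k , e ⟫ ⟪ l , f ⟫ =
    ⟪ k + l , trans (regroup a b c d) (trans (cong₂ _+_ e f) (sym (ℤP.*-distribʳ-+ (+ s) k l))) ⟫
    where regroup : ∀ a b c d → (a + c) - (b + d) ≡ (a - b) + (c - d)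
          regroup = solve-∀

  ≈-*ʳ : ∀ {a b} c → a ≈ b → a * c ≈ b * c
  ≈-*ʳ {a} {b} c ⟪ k , e ⟫ = ⟪ k * c , trans (factor a b c) (trans (cong (_* c) e) (swap k (+ s) c)) ⟫
    where factor : ∀ a b c → a * c - b * c ≡ (a - b) * c
          factor = solve-∀
          swap : ∀ k s c → k * s * c ≡ k * c * s
          swap = solve-∀

  ≈-subst : ∀ {x y x′ y′} → x ≈ y → x ≡ x′ → y ≡ y′ → x′ ≈ y′
  ≈-subst e refl refl = e

  +-multiple : ∀ x k → x + k * + s ≈ x
  +-multiple x k = ⟪ k , cancel x k (+ s) ⟫
    where cancel : ∀ x k s → x + k * s - x ≡ k * s
          cancel = solve-∀

  pos-% : ∀ n → + n ≈ + (n % s)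
  pos-% n = ≈-subst (+-multiple (+ (n % s)) (+ (n / s))) (sym division) refl
    where
      division : + n ≡ + (n % s) + + (n / s) * + s
      division = trans (cong +_ (m≡m%n+[m/n]*n n s))
                   (trans (ℤP.pos-+ (n % s) (n / s ℕ.* s)) (cong (λ w → + (n % s) + w) (ℤP.pos-* (n / s) s)))

  mod-≈ : ∀ n → + toℕ (n mod s) ≈ + n
  mod-≈ n = subst (_≈ + n) (cong +_ (sym (FP.toℕ-fromℕ< (m%n<n n s)))) (≈-sym (pos-% n))

  ≈⇒%≡ : ∀ {a b} → + a ≈ + b → a % s ≡ b % s
  ≈⇒%≡ {a} {b} ⟪ + m , e ⟫ = trans (cong (_% s) a≡) ([m+kn]%n≡m%n b m s)
    where
      rearrange : ∀ a b → a ≡ b + (a - b)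
      rearrange = solve-∀
      a≡ : a ≡ b ℕ.+ m ℕ.* s
      a≡ = ℤP.+-injective (trans (rearrange (+ a) (+ b))
             (trans (cong (λ w → + b + w) (trans e (sym (ℤP.pos-* m s)))) (sym (ℤP.pos-+ b (m ℕ.* s)))))
  ≈⇒%≡ {a} {b} ⟪ -[1+ m ] , e ⟫ = sym (trans (cong (_% s) b≡) ([m+kn]%n≡m%n a (suc m) s))
    where
      rearrange : ∀ a b → b ≡ a + - (a - b)
      rearrange = solve-∀
      b≡ : b ≡ a ℕ.+ suc m ℕ.* s
      b≡ = ℤP.+-injective (trans (rearrange (+ a) (+ b)) (trans (cong (λ w → + a + - w) e)
             (trans (cong (λ w → + a + w) (trans (ℤP.neg-distribˡ-* -[1+ m ] (+ s)) (sym (ℤP.pos-* (suc m) s))))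
               (sym (ℤP.pos-+ a (suc m ℕ.* s))))))

  ≈⇒≡ : ∀ {i j : Fin s} → + toℕ i ≈ + toℕ j → i ≡ j
  ≈⇒≡ {i} {j} e = FP.toℕ-injective (trans (sym (m<n⇒m%n≡m (FP.toℕ<n i)))
                    (trans (≈⇒%≡ e) (m<n⇒m%n≡m (FP.toℕ<n j))))

  residue : ℤ → Fin s
  residue z = fromℕ< (ℤD.n%ℕd<d z s)

  residue-≈ : ∀ z → z ≈ + toℕ (residue z)
  residue-≈ z rewrite FP.toℕ-fromℕ< (ℤD.n%ℕd<d z s) =
    ≈-subst (+-multiple (+ (z ℤD.%ℕ s)) (z ℤD./ℕ s)) (sym (ℤD.a≡a%ℕn+[a/ℕn]*n z s)) refl

  residue-unique : ∀ z j → z ≈ + toℕ j → residue z ≡ j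
  residue-unique z j z≈j = ≈⇒≡ (≈-trans (≈-sym (residue-≈ z)) z≈j)

module PartitionFacts where

  open import Data.Nat as ℕ using (ℕ; zero; suc; z≤n; s≤s; _≤_; _<_; _+_)
  import Data.Nat.Properties as NP
  open import Data.Nat.Tactic.RingSolver using (solve-∀)
  open import Data.List using (List; []; _∷_; length; filter)
  import Data.List.Properties as LP
  open import Data.List.Relation.Unary.All as All using (All; []; _∷_)
  open import Data.List.Relation.Unary.Linked using (Linked; []; [-]; _∷_)
  open import Data.List.Relation.Unary.Linked.Properties using (Linked⇒All)
  open import Data.Product using (_,_)
  open import Data.Empty using (⊥-elim)
  open import Relation.Nullary using (¬_; yes; no)
  open import Relation.Binary.Definitions using (tri<; tri≈; tri>)
  open import Relation.Binary.PropositionalEquality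

  Antitone : List ℕ → Set
  Antitone = Linked ℕ._≥_

  antitone-tail : ∀ {x ps} → Antitone (x ∷ ps) → Antitone ps
  antitone-tail [-]     = []
  antitone-tail (_ ∷ l) = l

  head-bounds : ∀ {x ps} → Antitone (x ∷ ps) → All (_≤ x) ps
  head-bounds [-]       = []
  head-bounds (x≥y ∷ l) = Linked⇒All (λ p q → NP.≤-trans q p) x≥y l

  partAt-bounded : ∀ {b ps} → All (_≤ b) ps → ∀ i → partAt ps i ≤ b
  partAt-bounded []       i       = z≤n
  partAt-bounded (p ∷ _)  zero    = p
  partAt-bounded (_ ∷ ps) (suc i) = partAt-bounded ps i

  partAt-≤-head : ∀ {x ps} → Antitone (x ∷ ps) → ∀ i → partAt (x ∷ ps) i ≤ x
  partAt-≤-head l zero    = NP.≤-refl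
  partAt-≤-head l (suc i) = partAt-bounded (head-bounds l) i

  partAt-antitone : ∀ {ps} → Antitone ps → ∀ {i j} → i ≤ j → partAt ps j ≤ partAt ps i
  partAt-antitone {[]}     l             _         = z≤n
  partAt-antitone {x ∷ ps} l {zero}  {j} _         = partAt-≤-head l j
  partAt-antitone {x ∷ ps} l {suc i} {suc j} (s≤s i≤j) = partAt-antitone (antitone-tail l) i≤j

  partAt-beyond : ∀ ps i → length ps ≤ i → partAt ps i ≡ 0
  partAt-beyond []       i       _       = refl
  partAt-beyond (x ∷ ps) (suc i) (s≤s p) = partAt-beyond ps i p

  countAbove : List ℕ → ℕ → ℕ
  countAbove ps c = length (filter (c ℕ.<?_) ps)

  countAbove-∷-above : ∀ {x ps c} → c < x → countAbove (x ∷ ps) c ≡ suc (countAbove ps c)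
  countAbove-∷-above {c = c} c<x = cong length (LP.filter-accept (c ℕ.<?_) c<x)

  countAbove-∷-below : ∀ {x ps c} → ¬ c < x → countAbove (x ∷ ps) c ≡ countAbove ps c
  countAbove-∷-below {c = c} c≮x = cong length (LP.filter-reject (c ℕ.<?_) c≮x)

  countAbove-bounded : ∀ {ps c} → All (_≤ c) ps → countAbove ps c ≡ 0
  countAbove-bounded []        = refl
  countAbove-bounded (x≤c ∷ a) = trans (countAbove-∷-below (NP.≤⇒≯ x≤c)) (countAbove-bounded a)

  <part⇒<count : ∀ {ps} → Antitone ps → ∀ c i → c < partAt ps i → i < countAbove ps c
  <part⇒<count {x ∷ ps} l c i c<pᵢ with c ℕ.<? x
  ... | no c≮x = ⊥-elim (c≮x (NP.<-≤-trans c<pᵢ (partAt-≤-head l i)))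
  <part⇒<count {x ∷ ps} l c zero    _    | yes c<x rewrite countAbove-∷-above {ps = ps} c<x = s≤s z≤n
  <part⇒<count {x ∷ ps} l c (suc i) c<pᵢ | yes c<x rewrite countAbove-∷-above {ps = ps} c<x =
    s≤s (<part⇒<count (antitone-tail l) c i c<pᵢ)

  <count⇒<part : ∀ {ps} → Antitone ps → ∀ c i → i < countAbove ps c → c < partAt ps i
  <count⇒<part {x ∷ ps} l c i i<p′ with c ℕ.<? x
  <count⇒<part {x ∷ ps} l c zero    _          | yes c<x = c<x
  <count⇒<part {x ∷ ps} l c (suc i) i<p′ | yes c<x rewrite countAbove-∷-above {ps = ps} c<x =
    <count⇒<part (antitone-tail l) c i (NP.≤-pred i<p′)
  ... | no c≮x = ⊥-elim (NP.n≮0 (subst (i <_) (countAbove-bounded bounded) i<p′))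
    where
      x≤c : x ≤ c
      x≤c = NP.≮⇒≥ c≮x
      bounded : All (_≤ c) (x ∷ ps)
      bounded = x≤c ∷ All.map (λ y≤x → NP.≤-trans y≤x x≤c) (head-bounds l)

  -- A point (i , c) is never on the boundary  c + i + 1 = λᵢ + λ'_c :
  -- either it is a cell (both summands on the right are larger) or it is not
  -- (both are at most the corresponding ones on the left).
  boundary-mismatch : ∀ {ps} → Antitone ps → ∀ c i → c + suc i ≢ partAt ps i + countAbove ps c
  boundary-mismatch {ps} l c i eq with i ℕ.<? countAbove ps c
  ... | yes i<p′ = NP.<-irrefl eq (NP.+-mono-<-≤ (<count⇒<part l c i i<p′) i<p′)
  ... | no i≮p′  = NP.<-irrefl (sym eq)
        (NP.+-mono-≤-< (NP.≮⇒≥ (λ c<pᵢ → i≮p′ (<part⇒<count l c i c<pᵢ))) (s≤s (NP.≮⇒≥ i≮p′)))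

  countAbove-exact : ∀ {ps} → Antitone ps → ∀ c m →
    (∀ i → i < m → c < partAt ps i) → (∀ i → m ≤ i → partAt ps i ≤ c) → countAbove ps c ≡ m
  countAbove-exact {ps} l c m above below with NP.<-cmp (countAbove ps c) m
  ... | tri< k<m _ _ = ⊥-elim (NP.<-irrefl refl (<part⇒<count l c _ (above _ k<m)))
  ... | tri≈ _ k≡m _ = k≡m
  ... | tri> _ _ m<k = ⊥-elim (NP.<⇒≱ (<count⇒<part l c m m<k) (below m NP.≤-refl))

  hook-sum : ∀ la r c → InDiagram la r c →
    hookLength la r c + (c + suc r) ≡ part la r + conj la c
  hook-sum la r c c<pᵣ = begin
      (arm + leg) + 1 + (c + suc r)   ≡⟨ regroup arm leg c r ⟩
      (arm + suc c) + (leg + suc r)   ≡⟨ cong₂ _+_ (NP.m∸n+n≡m c<pᵣ) (NP.m∸n+n≡m r<p′) ⟩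
      part la r + conj la c           ∎
    where
      open ≡-Reasoning
      arm leg : ℕ
      arm = part la r ℕ.∸ suc c
      leg = conj la c ℕ.∸ suc r
      r<p′ : r < conj la c
      r<p′ = <part⇒<count (decreasing la) c r c<pᵣ
      regroup : ∀ a b c r → (a + b) + 1 + (c + suc r) ≡ (a + suc c) + (b + suc r)
      regroup = solve-∀

module HookGaps where

  open import Data.Nat as ℕ using (ℕ; zero; suc; z≤n; s≤s; _≤_; _<_; _+_; _∸_)
  import Data.Nat.Properties as NP
  open import Data.Nat.Tactic.RingSolver using (solve-∀)
  open import Data.Integer using (ℤ; +_; _-_)
  open import Data.Product using (Σ; _×_; _,_; proj₁; proj₂)
  open import Data.Empty using (⊥-elim)
  open import Relation.Nullary using (¬_; yes; no)
  open import Relation.Unary using (Decidable)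
  open import Relation.Binary.PropositionalEquality
  open IntegerFacts
  open PartitionFacts

  β : Partition → ℕ → ℤ
  β la r = + part la r - + suc r

  -- If (r , c) has hook length h, then βᵣ - h = βᵢ would put (i , c) on the
  -- boundary  c + i + 1 = λᵢ + λ'_c , which is impossible.
  hook⇒gap : ∀ la r c h → InDiagram la r c → hookLength la r c ≡ h → ¬ InBeta la (β la r - + h)
  hook⇒gap la r c h inD hl (i , e) = boundary-mismatch (decreasing la) c i on-boundary
    where
      pᵣ pᵢ p′ : ℕ
      pᵣ = part la r
      pᵢ = part la i
      p′ = conj la c
      same-β : pᵣ + suc i ≡ pᵢ + (suc r + h)
      same-β = pos-diff₂-≡⁻ pᵣ (suc r) h pᵢ (suc i) e
      on-boundary : c + suc i ≡ pᵢ + p′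
      on-boundary = NP.+-cancelʳ-≡ (suc r + h) _ _ (begin
        c + suc i + (suc r + h)                   ≡⟨ shuffle₁ c i r h ⟩
        (h + (c + suc r)) + suc i                 ≡⟨ cong (λ w → (w + (c + suc r)) + suc i) (sym hl) ⟩
        (hookLength la r c + (c + suc r)) + suc i ≡⟨ cong (_+ suc i) (hook-sum la r c inD) ⟩
        pᵣ + p′ + suc i                           ≡⟨ shuffle₂ pᵣ p′ (suc i) ⟩
        pᵣ + suc i + p′                           ≡⟨ cong (_+ p′) same-β ⟩
        pᵢ + (suc r + h) + p′                     ≡⟨ shuffle₂ pᵢ (suc r + h) p′ ⟩
        pᵢ + p′ + (suc r + h)                     ∎)
        where
          open ≡-Reasoning
          shuffle₁ : ∀ c i r h → c + suc i + (suc r + h) ≡ (h + (c + suc r)) + suc i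
          shuffle₁ = solve-∀
          shuffle₂ : ∀ a b c → a + b + c ≡ a + c + b
          shuffle₂ = solve-∀

  closed⇒core : ∀ la h → (∀ z → InBeta la z → InBeta la (z - + h)) → IsCore h la
  closed⇒core la h closed r c inD hl = hook⇒gap la r c h inD hl (closed (β la r) (r , refl))

  least : ∀ {P : ℕ → Set} → Decidable P → ∀ {N} → P N → Σ ℕ λ m → P m × (∀ i → i < m → ¬ P i)
  least {P} P? {N} pN = search N 0 (λ _ ()) pN
    where
      search : ∀ f k → (∀ i → i < k → ¬ P i) → P (k + f) → Σ ℕ λ m → P m × (∀ i → i < m → ¬ P i)
      search f k none pkf with P? k
      ... | yes pk = k , pk , none
      search zero    k none pk  | no ¬pk = ⊥-elim (¬pk (subst P (NP.+-identityʳ k) pk))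
      search (suc f) k none pkf | no ¬pk = search f (suc k) none′ (subst P (NP.+-suc k f) pkf)
        where
          none′ : ∀ i → i < suc k → ¬ P i
          none′ i i<1+k with i ℕ.≟ k
          ... | yes refl = ¬pk
          ... | no i≢k   = none i (NP.≤∧≢⇒< (NP.≤-pred i<1+k) i≢k)

  -- Conversely a gap βᵣ - h (h > 0) comes from a cell (r , c): c is read off
  -- from the first row m whose β drops below βᵣ - h, and then λ'_c = m.
  module _ (la : Partition) (r h : ℕ) (0<h : 0 < h) (gap : ¬ InBeta la (β la r - + h)) where
    private
      p : ℕ → ℕ
      p = part la
      dec : Antitone (parts la)
      dec = decreasing la
      X : ℕ
      X = suc r + h
      -- βᵢ < βᵣ - h  iff  u i < v i ;  βᵢ = βᵣ - h  iff  u i = v i.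
      u v : ℕ → ℕ
      u i = p i + X
      v i = p r + suc i

      u≢v : ∀ i → u i ≢ v i
      u≢v i e = gap (i , pos-diff₂-≡ (p r) (suc r) h (p i) (suc i) (sym e))

      below-at-r+h : u (r + h) < v (r + h)
      below-at-r+h = NP.≤∧≢⇒< (NP.+-monoˡ-≤ X (partAt-antitone dec (NP.m≤m+n r h))) (u≢v (r + h))

      first : Σ ℕ λ m → u m < v m × (∀ i → i < m → ¬ u i < v i)
      first = least (λ i → u i ℕ.<? v i) below-at-r+h
      m : ℕ
      m = proj₁ first

      below-at-m : u m < v m
      below-at-m = proj₁ (proj₂ first)

      above-before-m : ∀ i → i < m → v i < u i
      above-before-m i i<m = NP.≤∧≢⇒< (NP.≮⇒≥ (proj₂ (proj₂ first) i i<m)) (λ e → u≢v i (sym e))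

      r<m : r < m
      r<m = NP.≰⇒> λ m≤r → NP.<⇒≱ below-at-m
              (NP.+-mono-≤ (partAt-antitone dec m≤r) (NP.≤-trans (s≤s m≤r) (NP.m≤m+n (suc r) h)))

      m<X : m < X
      m<X = s≤s (NP.≮⇒≥ λ r+h<m → NP.<⇒≱ (above-before-m (r + h) r+h<m) (NP.<⇒≤ below-at-r+h))

      X≤pᵣ+m : X ≤ p r + m
      X≤pᵣ+m = NP.≤-pred (NP.≤-<-trans (NP.m≤n+m X (p m)) (subst (u m <_) (NP.+-suc (p r) m) below-at-m))

      c : ℕ
      c = p r + m ∸ X

      c+X : c + X ≡ p r + m
      c+X = NP.m∸n+n≡m X≤pᵣ+m

      c<pᵣ : c < p r
      c<pᵣ = NP.+-cancelʳ-< X c (p r) (subst (_< p r + X) (sym c+X) (NP.+-monoʳ-< (p r) m<X))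

      rows-above : ∀ i → i < m → c < p i
      rows-above i i<m = NP.<-≤-trans c<pₘ₋₁ (partAt-antitone dec (NP.≤-pred (subst (i <_) (sym m≡) i<m)))
        where
          m≡ : suc (ℕ.pred m) ≡ m
          m≡ = NP.suc-pred m {{ℕ.>-nonZero (NP.≤-<-trans z≤n r<m)}}
          c<pₘ₋₁ : c < p (ℕ.pred m)
          c<pₘ₋₁ = NP.+-cancelʳ-< X c (p (ℕ.pred m))
            (subst (_< u (ℕ.pred m)) (trans (cong (λ w → p r + w) m≡) (sym c+X))
              (above-before-m (ℕ.pred m) (subst (ℕ.pred m <_) m≡ NP.≤-refl)))

      rows-below : ∀ i → m ≤ i → p i ≤ c
      rows-below i m≤i = NP.≤-trans (partAt-antitone dec m≤i)
        (NP.+-cancelʳ-≤ X (p m) c (subst (u m ≤_) (sym c+X)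
          (NP.≤-pred (subst (u m <_) (NP.+-suc (p r) m) below-at-m))))

      p′c≡m : conj la c ≡ m
      p′c≡m = countAbove-exact dec c m rows-above rows-below

    gap⇒hook : Σ ℕ λ c → InDiagram la r c × hookLength la r c ≡ h
    gap⇒hook = c , c<pᵣ , NP.+-cancelʳ-≡ (c + suc r) _ _ (begin
      hookLength la r c + (c + suc r) ≡⟨ hook-sum la r c c<pᵣ ⟩
      p r + conj la c                 ≡⟨ cong (λ w → p r + w) p′c≡m ⟩
      p r + m                         ≡⟨ sym c+X ⟩
      c + (suc r + h)                 ≡⟨ shuffle c r h ⟩
      h + (c + suc r)                 ∎)
      where
        open ≡-Reasoning
        shuffle : ∀ c r h → c + (suc r + h) ≡ h + (c + suc r)
        shuffle = solve-∀

-- Beta-sets described by an s-set q : the beta-set of ν is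
--   {z : z < q_{z mod s}}.
-- This holds for every s-core ν with 𝒬(ν) = q, because z ∈ beta-set forces
-- z - s ∈ beta-set (a gap βᵣ - s would be an s-hook); conversely such a
-- description makes ν an s-core, and more generally an h-core as soon as
-- q_c ≤ q_d + h whenever c ≡ d + h.
module DescribedBeta (s : ℕ) .{{_ : NonZero s}} where

  open import Data.Nat as ℕ using (ℕ; zero; suc; NonZero)
  open import Data.Integer as ℤ using (ℤ; +_; -[1+_]; _+_; _*_; _-_; _≤_; _<_; 0ℤ)
  import Data.Integer.Properties as ℤP
  open import Data.Integer.Tactic.RingSolver using (solve-∀)
  open import Data.Fin using (Fin; toℕ)
  open import Data.Product using (Σ; _×_; _,_; proj₁; proj₂)
  open import Relation.Nullary using (¬_)
  open import Relation.Binary.PropositionalEquality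
  open IntegerFacts
  open Residues s
  open HookGaps

  Describes : (Fin s → ℤ) → Partition → Set
  Describes q ν = ∀ z → (InBeta ν z → z < q (residue z)) × (z < q (residue z) → InBeta ν z)

  StepBounded : ℕ → (Fin s → ℤ) → Set
  StepBounded h q = ∀ c d → + toℕ c ≈ + toℕ d + + h → q c ≤ q d + + h

  described⇒core : ∀ {q ν} h → Describes q ν → StepBounded h q → IsCore h ν
  described⇒core {q} {ν} h described bounded = closed⇒core ν h closed
    where
      closed : ∀ z → InBeta ν z → InBeta ν (z - + h)
      closed z inB = proj₂ (described (z - + h))
        (<-by-diff (ℤP.<-≤-trans (proj₁ (described z) inB) (bounded c d c≈d+h)) (shift (q d) (+ h) z))
        where
          c d : Fin s
          c = residue z
          d = residue (z - + h)
          cancel : ∀ z h → (z - h) + h ≡ z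
          cancel = solve-∀
          shift : ∀ x h z → (x + h) - z ≡ x - (z - h)
          shift = solve-∀
          c≈d+h : + toℕ c ≈ + toℕ d + + h
          c≈d+h = ≈-trans (≈-sym (residue-≈ z))
                    (≈-subst (≈-+ (residue-≈ (z - + h)) (≈-refl {+ h})) (cancel z (+ h)) refl)

  described⇒IsQ : ∀ {q ν} → (∀ c → q c ≈ + toℕ c) → Describes q ν → IsQ s ν q
  described⇒IsQ {q} {ν} q-≈ described i = un (q-≈ i) , q∉beta , below⇒beta
    where
      q∉beta : ¬ InBeta ν (q i)
      q∉beta inB = ℤP.<-irrefl refl
        (subst (λ c → q i < q c) (residue-unique (q i) i (q-≈ i)) (proj₁ (described (q i)) inB))
      below⇒beta : ∀ z → z ≡[ s ] (+ toℕ i) → z < q i → InBeta ν z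
      below⇒beta z z≡i z<q = proj₂ (described z) (subst (λ c → z < q c) (sym (residue-unique z i ⟪ z≡i ⟫)) z<q)

  module _ {ν : Partition} {q : Fin s → ℤ} (isQ : IsQ s ν q) (core : IsCore s ν) where

    q-≈ : ∀ j → q j ≈ + toℕ j
    q-≈ j = ⟪ proj₁ (isQ j) ⟫

    -- No q_j + n·s lies in the beta-set (induction on n: if q_j + (n+1)·s = βᵣ,
    -- then βᵣ - s = q_j + n·s is a gap and row r would contain an s-hook).
    above-q∉beta : ∀ j n → ¬ InBeta ν (q j + + n * + s)
    above-q∉beta j zero    inB = proj₁ (proj₂ (isQ j)) (subst (InBeta ν) (ℤP.+-identityʳ (q j)) inB)
    above-q∉beta j (suc n) (r , q+s≡β) = no-s-hook (gap⇒hook ν r s (ℕ.>-nonZero⁻¹ s) gap)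
      where
        step : ∀ a n s → (a + (+ 1 + n) * s) - s ≡ a + n * s
        step = solve-∀
        β-s≡ : β ν r - + s ≡ q j + + n * + s
        β-s≡ = trans (cong (_- + s) (sym q+s≡β)) (step (q j) (+ n) (+ s))
        gap : ¬ InBeta ν (β ν r - + s)
        gap inB = above-q∉beta j n (subst (InBeta ν) β-s≡ inB)
        no-s-hook : ¬ (Σ ℕ λ c → InDiagram ν r c × hookLength ν r c ≡ s)
        no-s-hook (c , inD , hook≡s) = core r c inD hook≡s

    -- if q_j ≤ z ≡ q_j, then z = q_j + n·s with n ≥ 0
    beta⇒below-q : ∀ z → InBeta ν z → z < q (residue z)
    beta⇒below-q z inB = ℤP.≰⇒> (λ q≤z → excluded q≤z (≈-trans (residue-≈ z) (≈-sym (q-≈ j))))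
      where
        j = residue z
        excluded : q j ≤ z → ¬ z ≈ q j
        excluded q≤z ⟪ + n , z-q≡ns ⟫ = above-q∉beta j n (subst (InBeta ν) z≡ inB)
          where
            rearrange : ∀ z q → z ≡ q + (z - q)
            rearrange = solve-∀
            z≡ : z ≡ q j + + n * + s
            z≡ = trans (rearrange z (q j)) (cong (λ w → q j + w) z-q≡ns)
        excluded q≤z ⟪ -[1+ n ] , z-q≡ns ⟫ =
          ℤP.<⇒≱ (subst (_< 0ℤ) (sym z-q≡ns) (negative-multiple n s)) (ℤP.i≤j⇒0≤j-i q≤z)
          where
            negative-multiple : ∀ n m .{{_ : NonZero m}} → -[1+ n ] * + m < 0ℤ
            negative-multiple n (suc m) = ℤ.-<+

    core⇒described : Describes q ν
    core⇒described z = beta⇒below-q z , proj₂ (proj₂ (isQ (residue z))) z (un (residue-≈ z))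

-- After shifting by n ≥ ℓ(λ)
-- the part of the beta-set above -n is a strictly decreasing list of n
-- naturals; conversely every strictly decreasing list D of naturals is the
-- shifted top of the beta-set of a partition (shift |D|).
module BetaLists where

  open import Data.Nat as ℕ using (ℕ; zero; suc; z≤n; s≤s; _≤_; _<_; _>_; _+_; _∸_)
  import Data.Nat.Properties as NP
  open import Data.Integer as ℤ using (ℤ; +_; -[1+_]; _-_; -_)
  import Data.Integer.Properties as ℤP
  open import Data.List using (List; []; _∷_; length; filter; applyUpTo)
  import Data.List.Properties as LP
  open import Data.List.Relation.Unary.All as All using (All; []; _∷_)
  open import Data.List.Relation.Unary.All.Properties using (all-filter)
  open import Data.List.Relation.Unary.Any using (here; there)
  open import Data.List.Membership.Propositional using (_∈_)
  open import Data.List.Relation.Unary.Linked using (Linked; []; [-]; _∷_)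
  open import Data.List.Relation.Unary.Linked.Properties as Linked using (Linked⇒All; applyUpTo⁺₁)
  open import Data.Product using (Σ; _×_; _,_)
  open import Data.Sum using (_⊎_; inj₁; inj₂)
  open import Data.Empty using (⊥-elim)
  open import Relation.Nullary using (yes; no; Dec)
  open import Relation.Binary.PropositionalEquality
  open IntegerFacts
  open PartitionFacts
  open HookGaps using (β)

  StrictlyDecreasing : List ℕ → Set
  StrictlyDecreasing = Linked ℕ._>_

  sd-tail : ∀ {x xs} → StrictlyDecreasing (x ∷ xs) → StrictlyDecreasing xs
  sd-tail [-]     = []
  sd-tail (_ ∷ l) = l

  sd-head-max : ∀ {k x xs} → StrictlyDecreasing (x ∷ xs) → k ∈ x ∷ xs → k ≤ x
  sd-head-max l           (here refl) = NP.≤-refl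
  sd-head-max [-]         (there ())
  sd-head-max (x>y ∷ l)   (there k∈)  = NP.<⇒≤ (All.lookup (Linked⇒All (λ p q → NP.<-trans q p) x>y l) k∈)

  ∈⇒partAt : ∀ {k xs} → k ∈ xs → Σ ℕ λ i → i < length xs × partAt xs i ≡ k
  ∈⇒partAt (here refl) = 0 , s≤s z≤n , refl
  ∈⇒partAt (there k∈) with ∈⇒partAt k∈
  ... | i , i<n , eq = suc i , s≤s i<n , eq

  partAt-∈ : ∀ xs i → i < length xs → partAt xs i ∈ xs
  partAt-∈ (x ∷ xs) zero    _       = here refl
  partAt-∈ (x ∷ xs) (suc i) (s≤s p) = there (partAt-∈ xs i p)

  same-members⇒same-length : ∀ {xs ys} → StrictlyDecreasing xs → StrictlyDecreasing ys →
    (∀ k → k ∈ xs → k ∈ ys) → (∀ k → k ∈ ys → k ∈ xs) → length xs ≡ length ys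
  same-members⇒same-length {[]}     {[]}     _  _  _ _ = refl
  same-members⇒same-length {[]}     {y ∷ ys} _  _  _ g with () ← g y (here refl)
  same-members⇒same-length {x ∷ xs} {[]}     _  _  f _ with () ← f x (here refl)
  same-members⇒same-length {x ∷ xs} {y ∷ ys} lx ly f g =
    cong suc (same-members⇒same-length (sd-tail lx) (sd-tail ly) (drop lx ly f) (drop ly lx g))
    where
      drop : ∀ {x xs y ys} → StrictlyDecreasing (x ∷ xs) → StrictlyDecreasing (y ∷ ys) →
             (∀ k → k ∈ x ∷ xs → k ∈ y ∷ ys) → (∀ k → k ∈ xs → k ∈ ys)
      drop {x} {xs} {y} {ys} lx ly f k k∈ with f k (there k∈)
      ... | there k∈′ = k∈′
      ... | here refl = ⊥-elim (NP.<⇒≱ (All.lookup (tail-below lx) k∈) (sd-head-max ly (f x (here refl))))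
        where
          tail-below : ∀ {x xs} → StrictlyDecreasing (x ∷ xs) → All (_< x) xs
          tail-below [-]       = []
          tail-below (x>y ∷ l) = Linked⇒All (λ p q → NP.<-trans q p) x>y l

  below-length⇒beta : ∀ la {z} → z ℤ.< - (+ length (parts la)) → InBeta la z
  below-length⇒beta la {+ n}      z<-ℓ = ⊥-elim (ℤP.<⇒≱ z<-ℓ (ℤP.≤-trans ℤP.neg-≤-pos (ℤ.+≤+ z≤n)))
  below-length⇒beta la { -[1+ j ]} z<-ℓ =
    j , cong (λ w → + w - + suc j) (sym (partAt-beyond (parts la) j (ℓ≤j (length (parts la)) z<-ℓ)))
    where
      ℓ≤j : ∀ ℓ → -[1+ j ] ℤ.< - (+ ℓ) → ℓ ≤ j
      ℓ≤j zero    _             = z≤n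
      ℓ≤j (suc ℓ) (ℤ.-<- ℓ<1+j) = ℓ<1+j

  -- From a strictly decreasing list D to a partition:  λᵢ = Dᵢ - (|D| - 1 - i).

  rowsOf : List ℕ → List ℕ
  rowsOf []       = []
  rowsOf (d ∷ ds) = (d ∸ length ds) ∷ rowsOf ds

  length-rowsOf : ∀ D → length (rowsOf D) ≡ length D
  length-rowsOf []       = refl
  length-rowsOf (d ∷ ds) = cong suc (length-rowsOf ds)

  -- d ≥ |ds| for a strictly decreasing list d ∷ ds of naturals, so the
  -- subtraction in rowsOf is exact.
  length≤head : ∀ {d ds} → StrictlyDecreasing (d ∷ ds) → length ds ≤ d
  length≤head [-]       = z≤n
  length≤head (d>d′ ∷ l) = NP.≤-trans (s≤s (length≤head l)) d>d′

  rowsOf-antitone : ∀ {D} → StrictlyDecreasing D → Antitone (rowsOf D)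
  rowsOf-antitone []               = []
  rowsOf-antitone [-]              = [-]
  rowsOf-antitone {_ ∷ _ ∷ ds} (d>d′ ∷ l) = NP.∸-monoˡ-≤ (suc (length ds)) d>d′ ∷ rowsOf-antitone l

  rowsOf-at : ∀ {D} → StrictlyDecreasing D → ∀ i → i < length D →
    partAt (rowsOf D) i + (length D ∸ suc i) ≡ partAt D i
  rowsOf-at {_ ∷ _} l zero    _       = NP.m∸n+n≡m (length≤head l)
  rowsOf-at {_ ∷ _} l (suc i) (s≤s p) = rowsOf-at (sd-tail l) i p

  positive? : ∀ x → Dec (0 < x)
  positive? x = 0 ℕ.<? x

  partAt-dropZeros : ∀ {ps} → Antitone ps → ∀ i → partAt (filter positive? ps) i ≡ partAt ps i
  partAt-dropZeros {[]}     _ i = refl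
  partAt-dropZeros {x ∷ ps} l i with positive? x
  partAt-dropZeros {x ∷ ps} l zero    | yes 0<x = cong (λ xs → partAt xs 0) (LP.filter-accept positive? 0<x)
  partAt-dropZeros {x ∷ ps} l (suc i) | yes 0<x =
    trans (cong (λ xs → partAt xs (suc i)) (LP.filter-accept positive? 0<x)) (partAt-dropZeros (antitone-tail l) i)
  ... | no x≯0 = trans (cong (λ xs → partAt xs i) (trans (LP.filter-reject positive? x≯0) (filter-zeros (head-bounds l))))
                       (sym (NP.n≤0⇒n≡0 (NP.≤-trans (partAt-≤-head l i) x≤0)))
    where
      x≤0 : x ≤ 0
      x≤0 = NP.≮⇒≥ x≯0
      filter-zeros : ∀ {xs} → All (_≤ x) xs → filter positive? xs ≡ []
      filter-zeros []          = refl
      filter-zeros (y≤x ∷ all) = trans (LP.filter-reject positive? (NP.≤⇒≯ (NP.≤-trans y≤x x≤0))) (filter-zeros all)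

  fromBeta : (D : List ℕ) → StrictlyDecreasing D → Partition
  fromBeta D l = mkPartition (filter positive? (rowsOf D))
    (Linked.filter⁺ positive? (λ p q → NP.≤-trans q p) (rowsOf-antitone l)) (all-filter positive? (rowsOf D))

  part-fromBeta : ∀ D (l : StrictlyDecreasing D) i → part (fromBeta D l) i ≡ partAt (rowsOf D) i
  part-fromBeta D l = partAt-dropZeros (rowsOf-antitone l)

  β-fromBeta : ∀ D (l : StrictlyDecreasing D) i → i < length D → β (fromBeta D l) i ≡ + partAt D i - + length D
  β-fromBeta D l i i<n = trans (cong (λ w → + w - + suc i) (part-fromBeta D l i)) (pos-diff-≡ pᵢ (suc i) (partAt D i) (length D) eq)
    where
      open ≡-Reasoning
      pᵢ : ℕ
      pᵢ = partAt (rowsOf D) i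
      eq : pᵢ + length D ≡ partAt D i + suc i
      eq = begin
        pᵢ + length D                     ≡⟨ cong (λ w → pᵢ + w) (sym (NP.m∸n+n≡m i<n)) ⟩
        pᵢ + ((length D ∸ suc i) + suc i) ≡⟨ sym (NP.+-assoc pᵢ _ (suc i)) ⟩
        pᵢ + (length D ∸ suc i) + suc i   ≡⟨ cong (_+ suc i) (rowsOf-at l i i<n) ⟩
        partAt D i + suc i                ∎

  beta-fromBeta⇒ : ∀ D (l : StrictlyDecreasing D) z → InBeta (fromBeta D l) z →
    (Σ ℕ λ k → k ∈ D × z ≡ + k - + length D) ⊎ (z ℤ.< - (+ length D))
  beta-fromBeta⇒ D l z (i , z≡βᵢ) with i ℕ.<? length D
  ... | yes i<n = inj₁ (partAt D i , partAt-∈ D i i<n , trans z≡βᵢ (β-fromBeta D l i i<n))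
  ... | no i≮n  = inj₂ (subst (ℤ._< - (+ length D)) (sym z≡) (below (length D) n≤i))
    where
      n≤i : length D ≤ i
      n≤i = NP.≮⇒≥ i≮n
      z≡ : z ≡ -[1+ i ]
      z≡ = trans z≡βᵢ (cong (λ w → + w - + suc i)
             (trans (part-fromBeta D l i) (partAt-beyond (rowsOf D) i (subst (_≤ i) (sym (length-rowsOf D)) n≤i))))
      below : ∀ n → n ≤ i → -[1+ i ] ℤ.< - (+ n)
      below zero    _       = ℤ.-<+
      below (suc n) (s≤s p) = ℤ.-<- (s≤s p)

  beta-fromBeta⇐ᴰ : ∀ D (l : StrictlyDecreasing D) k → k ∈ D → InBeta (fromBeta D l) (+ k - + length D)
  beta-fromBeta⇐ᴰ D l k k∈ with ∈⇒partAt k∈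
  ... | i , i<n , refl = i , sym (β-fromBeta D l i i<n)

  beta-fromBeta⇐ : ∀ D (l : StrictlyDecreasing D) z → z ℤ.< - (+ length D) → InBeta (fromBeta D l) z
  beta-fromBeta⇐ D l z z<-n = below-length⇒beta (fromBeta D l)
    (ℤP.<-≤-trans z<-n (ℤP.neg-mono-≤ (ℤ.+≤+ (subst (length (parts (fromBeta D l)) ≤_) (length-rowsOf D) (LP.length-filter positive? (rowsOf D))))))

  partAt-applyUpTo : ∀ f n i → i < n → partAt (applyUpTo f n) i ≡ f i
  partAt-applyUpTo f (suc n) zero    _       = refl
  partAt-applyUpTo f (suc n) (suc i) (s≤s p) = partAt-applyUpTo (λ j → f (suc j)) n i p

  shiftedBeta : Partition → ℕ → List ℕ
  shiftedBeta la n = applyUpTo (λ i → part la i + n ∸ suc i) n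

  length-shiftedBeta : ∀ la n → length (shiftedBeta la n) ≡ n
  length-shiftedBeta la n = LP.length-applyUpTo _ n

  shiftedBeta-decreasing : ∀ la n → StrictlyDecreasing (shiftedBeta la n)
  shiftedBeta-decreasing la n = applyUpTo⁺₁ _ n step
    where
      step : ∀ {i} → suc i < n → part la i + n ∸ suc i > part la (suc i) + n ∸ suc (suc i)
      step {i} i+1<n = begin-strict
        part la (suc i) + n ∸ suc (suc i) ≤⟨ NP.∸-monoˡ-≤ (suc (suc i)) (NP.+-monoˡ-≤ n (partAt-antitone (decreasing la) (NP.n≤1+n i))) ⟩
        part la i + n ∸ suc (suc i)       <⟨ NP.∸-monoʳ-< (NP.n<1+n (suc i)) (NP.≤-trans i+1<n (NP.m≤n+m n (part la i))) ⟩
        part la i + n ∸ suc i             ∎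
        where open NP.≤-Reasoning

  shiftedBeta⇒beta : ∀ la n k → k ∈ shiftedBeta la n → InBeta la (+ k - + n)
  shiftedBeta⇒beta la n k k∈ with ∈⇒partAt k∈
  ... | i , i<len , kᵢ≡k = i , pos-diff-≡ k n (part la i) (suc i) eq
    where
      open ≡-Reasoning
      i<n : i < n
      i<n = subst (i <_) (length-shiftedBeta la n) i<len
      eq : k + suc i ≡ part la i + n
      eq = begin
        k + suc i                        ≡⟨ cong (_+ suc i) (trans (sym kᵢ≡k) (partAt-applyUpTo _ n i i<n)) ⟩
        (part la i + n ∸ suc i) + suc i  ≡⟨ NP.m∸n+n≡m (NP.≤-trans i<n (NP.m≤n+m n (part la i))) ⟩
        part la i + n                    ∎

  beta⇒shiftedBeta : ∀ la n → length (parts la) ≤ n → ∀ k → InBeta la (+ k - + n) → k ∈ shiftedBeta la n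
  beta⇒shiftedBeta la n ℓ≤n k (i , e) with i ℕ.<? n
  ... | yes i<n = subst (_∈ shiftedBeta la n) kᵢ≡k
                    (partAt-∈ (shiftedBeta la n) i (subst (i <_) (sym (length-shiftedBeta la n)) i<n))
    where
      kᵢ≡k : partAt (shiftedBeta la n) i ≡ k
      kᵢ≡k = trans (partAt-applyUpTo _ n i i<n)
               (trans (cong (_∸ suc i) (sym (pos-diff-≡⁻ k n (part la i) (suc i) e))) (NP.m+n∸n≡m k (suc i)))
  ... | no i≮n = ⊥-elim (NP.<-irrefl (sym k+i+1≡n) (NP.≤-trans (s≤s (NP.≮⇒≥ i≮n)) (NP.m≤n+m (suc i) k)))
    where
      -- row i is empty, so k - n = -(i+1), i.e. k + i + 1 = n ≤ i: impossible
      k+i+1≡n : k + suc i ≡ n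
      k+i+1≡n = trans (pos-diff-≡⁻ k n (part la i) (suc i) e)
                  (cong (_+ n) (partAt-beyond (parts la) i (NP.≤-trans ℓ≤n (NP.≮⇒≥ i≮n))))

module RangeSums where

  open import Data.Nat as ℕ using (ℕ; zero; suc; z≤n; s≤s; _≤_; _<_; _+_; _*_)
  import Data.Nat.Properties as NP
  open import Data.Nat.Combinatorics using (_C_; nCk+nC[k+1]≡[n+1]C[k+1]; nC1≡n)
  open import Data.Fin using (Fin; toℕ)
  open import Data.List using (length; filter; downFrom)
  import Data.List.Properties as LP
  open import Relation.Nullary using (Dec; yes; no; contradiction)
  open import Relation.Binary.PropositionalEquality
  open import Algebra.Properties.Semiring.Sum NP.+-*-semiring using (sum)

  Σ< : ℕ → (ℕ → ℕ) → ℕ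
  Σ< zero    f = 0
  Σ< (suc N) f = f 0 + Σ< N (λ k → f (suc k))

  Σ<-cong : ∀ N {f g} → (∀ k → f k ≡ g k) → Σ< N f ≡ Σ< N g
  Σ<-cong zero    f≗g = refl
  Σ<-cong (suc N) f≗g = cong₂ _+_ (f≗g 0) (Σ<-cong N (λ k → f≗g (suc k)))

  Σ<-last : ∀ N f → Σ< (suc N) f ≡ Σ< N f + f N
  Σ<-last zero    f = NP.+-comm (f 0) 0
  Σ<-last (suc N) f = trans (cong (f 0 +_) (Σ<-last N (λ k → f (suc k)))) (sym (NP.+-assoc (f 0) _ _))

  Σ<-split : ∀ a b f → Σ< (a + b) f ≡ Σ< a f + Σ< b (λ k → f (a + k))
  Σ<-split zero    b f = refl
  Σ<-split (suc a) b f = trans (cong (f 0 +_) (Σ<-split a b (λ k → f (suc k)))) (sym (NP.+-assoc (f 0) _ _))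

  Σ<-blocks : ∀ s L f → Σ< (L * s) f ≡ Σ< L (λ m → Σ< s (λ r → f (m * s + r)))
  Σ<-blocks s zero    f = refl
  Σ<-blocks s (suc L) f = trans (Σ<-split s (L * s) f) (cong (Σ< s f +_) (trans (Σ<-blocks s L (λ k → f (s + k)))
    (Σ<-cong L (λ m → Σ<-cong s (λ r → cong f (sym (NP.+-assoc s (m * s) r)))))))

  Σ<-as-sum : ∀ n (g : ℕ → ℕ) → Σ< n g ≡ sum (λ (c : Fin n) → g (toℕ c))
  Σ<-as-sum zero    g = refl
  Σ<-as-sum (suc n) g = cong (g 0 +_) (Σ<-as-sum n (λ k → g (suc k)))

  Σ<-id : ∀ n → Σ< n (λ k → k) ≡ n C 2
  Σ<-id zero    = refl
  Σ<-id (suc n) = trans (Σ<-last n (λ k → k)) (trans (cong₂ _+_ (Σ<-id n) (sym (nC1≡n n)))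
                    (trans (NP.+-comm (n C 2) (n C 1)) (nCk+nC[k+1]≡[n+1]C[k+1] n 1)))

  sum-toℕ : ∀ n → sum (λ (c : Fin n) → toℕ c) ≡ n C 2
  sum-toℕ n = trans (sym (Σ<-as-sum n (λ k → k))) (Σ<-id n)

  indicator : ∀ {P : Set} → Dec P → ℕ
  indicator (yes _) = 1
  indicator (no _)  = 0

  indicator-cong : ∀ {P Q : Set} (p : Dec P) (q : Dec Q) → (P → Q) → (Q → P) → indicator p ≡ indicator q
  indicator-cong (yes _) (yes _) _ _ = refl
  indicator-cong (yes p) (no ¬q) f _ = contradiction (f p) ¬q
  indicator-cong (no ¬p) (yes q) _ g = contradiction (g q) ¬p
  indicator-cong (no _)  (no _)  _ _ = refl

  count-initial : ∀ L j → j ≤ L → Σ< L (λ m → indicator (m ℕ.<? j)) ≡ j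
  count-initial zero    zero    _       = refl
  count-initial (suc L) zero    _       = count-initial L zero z≤n
  count-initial (suc L) (suc j) (s≤s p) = cong suc (trans
    (Σ<-cong L (λ m → indicator-cong (suc m ℕ.<? suc j) (m ℕ.<? j) NP.≤-pred s≤s)) (count-initial L j p))

  length-filter-downFrom : ∀ {P : ℕ → Set} (P? : ∀ k → Dec (P k)) N →
    length (filter P? (downFrom N)) ≡ Σ< N (λ k → indicator (P? k))
  length-filter-downFrom P? zero    = refl
  length-filter-downFrom P? (suc N) = trans (top (P? N)) (sym (Σ<-last N _))
    where
      top : (d : Dec _) → length (filter P? (downFrom (suc N))) ≡ Σ< N (λ k → indicator (P? k)) + indicator d
      top (yes p) = trans (cong length (LP.filter-accept P? p))
                      (trans (cong suc (length-filter-downFrom P? N)) (NP.+-comm 1 _))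
      top (no ¬p) = trans (cong length (LP.filter-reject P? ¬p))
                      (trans (length-filter-downFrom P? N) (sym (NP.+-identityʳ _)))

module CountBelow (s : ℕ) .{{_ : NonZero s}} where

  open import Data.Nat as ℕ using (ℕ; _≤_; _<_; _+_; _*_)
  import Data.Nat.Properties as NP
  open import Data.Nat.DivMod using (_mod_; _%_; _/_; m≡m%n+[m/n]*n; [m+kn]%n≡m%n; m<n⇒m%n≡m; m%n<n; m/n*n≤m)
  open import Data.Nat.Combinatorics using (_C_)
  open import Data.Fin using (Fin; toℕ)
  import Data.Fin.Properties as FP
  open import Data.List using (List; length; filter; downFrom)
  open import Data.List.Membership.Propositional using (_∈_)
  open import Data.List.Membership.Propositional.Properties using (∈-filter⁺; ∈-filter⁻; ∈-downFrom⁺)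
  import Data.List.Relation.Unary.Linked.Properties as Linked
  open import Data.Product using (proj₂)
  open import Relation.Nullary using (Dec)
  open import Relation.Binary.PropositionalEquality
  open import Algebra.Properties.Semiring.Sum NP.+-*-semiring using (sum; sum-cong-≗; ∑-comm; ∑-distrib-+; *-distribʳ-sum)
  open RangeSums
  open BetaLists using (StrictlyDecreasing)

  module Count (Q : Fin s → ℕ) (L : ℕ) (Q-residue : ∀ c → Q c % s ≡ toℕ c) (Q≤ : ∀ c → Q c ≤ L * s) where

    Below : ℕ → Set
    Below k = k < Q (k mod s)

    below? : ∀ k → Dec (Below k)
    below? k = k ℕ.<? Q (k mod s)

    D : List ℕ
    D = filter below? (downFrom (L * s))

    D-decreasing : StrictlyDecreasing D
    D-decreasing = Linked.filter⁺ below? (λ p q → NP.<-trans q p)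
                     (Linked.applyDownFrom⁺₂ (λ k → k) (L * s) (λ i → NP.n<1+n i))

    ∈D⇒below-Q : ∀ k → k ∈ D → Below k
    ∈D⇒below-Q k k∈ = proj₂ (∈-filter⁻ below? {xs = downFrom (L * s)} k∈)

    below-Q⇒∈D : ∀ k → Below k → k ∈ D
    below-Q⇒∈D k k<Q = ∈-filter⁺ below? (∈-downFrom⁺ (NP.<-≤-trans k<Q (Q≤ (k mod s)))) k<Q

    -- the number of elements of D in residue class c
    j : Fin s → ℕ
    j c = Q c / s

    Q-division : ∀ c → Q c ≡ toℕ c + j c * s
    Q-division c = trans (m≡m%n+[m/n]*n (Q c) s) (cong (_+ j c * s) (Q-residue c))

    j≤L : ∀ c → j c ≤ L
    j≤L c = NP.*-cancelʳ-≤ (j c) L s (NP.≤-trans (m/n*n≤m (Q c) s) (Q≤ c))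

    block-residue : ∀ m (c : Fin s) → (m * s + toℕ c) mod s ≡ c
    block-residue m c = FP.toℕ-injective (trans (FP.toℕ-fromℕ< (m%n<n (m * s + toℕ c) s))
      (trans (cong (_% s) (NP.+-comm (m * s) (toℕ c))) (trans ([m+kn]%n≡m%n (toℕ c) m s) (m<n⇒m%n≡m (FP.toℕ<n c)))))

    count-class : ∀ (c : Fin s) → Σ< L (λ m → indicator (below? (m * s + toℕ c))) ≡ j c
    count-class c = trans (Σ<-cong L (λ m → indicator-cong (below? (m * s + toℕ c)) (m ℕ.<? j c) (⇒ m) (⇐ m)))
                          (count-initial L (j c) (j≤L c))
      where
        below⇔ : ∀ m → Below (m * s + toℕ c) ≡ (m * s + toℕ c < toℕ c + j c * s)
        below⇔ m = cong (λ d → m * s + toℕ c < d) (trans (cong Q (block-residue m c)) (Q-division c))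
        ⇒ : ∀ m → Below (m * s + toℕ c) → m < j c
        ⇒ m below = NP.≰⇒> λ j≤m → NP.<⇒≱ (subst (λ P → P) (below⇔ m) below)
          (NP.≤-trans (NP.≤-reflexive (NP.+-comm (toℕ c) (j c * s))) (NP.+-monoˡ-≤ (toℕ c) (NP.*-monoˡ-≤ s j≤m)))
        ⇐ : ∀ m → m < j c → Below (m * s + toℕ c)
        ⇐ m m<j = subst (λ P → P) (sym (below⇔ m))
          (subst (m * s + toℕ c <_) (NP.+-comm (j c * s) (toℕ c)) (NP.+-monoˡ-< (toℕ c) (NP.*-monoˡ-< s m<j)))

    length-D : length D ≡ sum j
    length-D = begin
      length D                                               ≡⟨ length-filter-downFrom below? (L * s) ⟩
      Σ< (L * s) (λ k → indicator (below? k))                ≡⟨ Σ<-blocks s L _ ⟩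
      Σ< L (λ m → Σ< s (ind m))                                ≡⟨ Σ<-as-sum L (λ m → Σ< s (ind m)) ⟩
      sum (λ (m : Fin L) → Σ< s (ind (toℕ m)))                 ≡⟨ sum-cong-≗ {L} (λ m → Σ<-as-sum s (ind (toℕ m))) ⟩
      sum (λ (m : Fin L) → sum (λ (c : Fin s) → ind′ m c))     ≡⟨ ∑-comm ind′ ⟩
      sum (λ (c : Fin s) → sum (λ (m : Fin L) → ind′ m c))     ≡⟨ sum-cong-≗ {s} (λ c → sym (Σ<-as-sum L (λ m → ind m (toℕ c)))) ⟩
      sum (λ (c : Fin s) → Σ< L (λ m → ind m (toℕ c)))         ≡⟨ sum-cong-≗ {s} count-class ⟩
      sum j                                                  ∎
      where
        open ≡-Reasoning
        ind : ℕ → ℕ → ℕ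
        ind m r = indicator (below? (m * s + r))
        ind′ : Fin L → Fin s → ℕ
        ind′ m c = ind (toℕ m) (toℕ c)

    sum-Q : sum Q ≡ s C 2 + sum j * s
    sum-Q = trans (sum-cong-≗ Q-division) (trans (∑-distrib-+ toℕ (λ c → j c * s))
              (cong₂ _+_ (sum-toℕ s) (sym (*-distribʳ-sum s j))))

module IntegerSums where

  open import Data.Nat using (ℕ; zero; suc)
  import Data.Nat.Properties as NP
  open import Data.Integer using (ℤ; +_; _+_; _*_; _-_; 0ℤ)
  import Data.Integer.Properties as ℤP
  open import Data.Integer.Tactic.RingSolver using (solve-∀)
  open import Data.Fin using (Fin; zero; suc)
  import Data.Fin.Properties as FP
  open import Data.List using (foldr; tabulate)
  import Data.List.Properties as LP
  open import Data.Empty using (⊥-elim)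
  open import Function using (_∘_)
  open import Relation.Binary.PropositionalEquality
  open import Algebra.Properties.Semiring.Sum ℤP.+-*-semiring public using (sum; sum-cong-≗; ∑-distrib-+)
  import Algebra.Properties.Semiring.Sum NP.+-*-semiring as ℕΣ

  foldr-tabulate : ∀ n (f : Fin n → ℤ) → foldr _+_ (+ 0) (tabulate f) ≡ sum f
  foldr-tabulate zero    f = refl
  foldr-tabulate (suc n) f = cong (λ w → f zero + w) (foldr-tabulate n (λ c → f (suc c)))

  sumSq≡sum : ∀ s (q : Fin s → ℤ) → sumSq s q ≡ sum (λ j → q j * q j)
  sumSq≡sum s q = trans (cong (foldr _+_ (+ 0)) (LP.map-tabulate q (λ x → x * x))) (foldr-tabulate s _)

  sum-const : ∀ n x → sum (λ (_ : Fin n) → x) ≡ + n * x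
  sum-const zero    x = refl
  sum-const (suc n) x = trans (cong (λ w → x + w) (sum-const n x)) (sym (ℤP.suc-* (+ n) x))

  sum-pos : ∀ n (g : Fin n → ℕ) → sum (λ c → + g c) ≡ + ℕΣ.sum g
  sum-pos zero    g = refl
  sum-pos (suc n) g = trans (cong (λ w → + g zero + w) (sum-pos n (λ c → g (suc c)))) (sym (ℤP.pos-+ (g zero) _))

  sum-difference : ∀ n (f g : Fin n → ℤ) → sum g ≡ sum f + sum (λ j → g j - f j)
  sum-difference n f g = trans (sum-cong-≗ (λ j → split (f j) (g j))) (∑-distrib-+ f _)
    where split : ∀ f g → g ≡ f + (g - f)
          split = solve-∀

  sum-zero : ∀ n (h : Fin n → ℤ) → (∀ j → h j ≡ 0ℤ) → sum h ≡ 0ℤ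
  sum-zero zero    h h≡0 = refl
  sum-zero (suc n) h h≡0 = cong₂ _+_ (h≡0 zero) (sum-zero n _ (λ j → h≡0 (suc j)))

  sum-one-point : ∀ n (h : Fin n → ℤ) a → (∀ j → j ≢ a → h j ≡ 0ℤ) → sum h ≡ h a
  sum-one-point (suc n) h zero    off = trans (cong (λ w → h zero + w) (sum-zero n _ (λ j → off (suc j) λ ()))) (ℤP.+-identityʳ _)
  sum-one-point (suc n) h (suc a) off = trans (cong₂ _+_ (off zero λ ())
    (sum-one-point n _ a (λ j j≢a → off (suc j) (j≢a ∘ FP.suc-injective)))) (ℤP.+-identityˡ _)

  sum-two-points : ∀ n (h : Fin n → ℤ) a b → a ≢ b → (∀ j → j ≢ a → j ≢ b → h j ≡ 0ℤ) → sum h ≡ h a + h b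
  sum-two-points (suc n) h zero    zero    a≢b off = ⊥-elim (a≢b refl)
  sum-two-points (suc n) h zero    (suc b) a≢b off =
    cong (λ w → h zero + w) (sum-one-point n _ b (λ j j≢b → off (suc j) (λ ()) (j≢b ∘ FP.suc-injective)))
  sum-two-points (suc n) h (suc a) zero    a≢b off =
    trans (cong (λ w → h zero + w) (sum-one-point n _ a (λ j j≢a → off (suc j) (j≢a ∘ FP.suc-injective) (λ ()))))
          (ℤP.+-comm (h zero) (h (suc a)))
  sum-two-points (suc n) h (suc a) (suc b) a≢b off =
    trans (cong₂ _+_ (off zero (λ ()) (λ ())) (sum-two-points n _ a b (a≢b ∘ cong suc)
      (λ j j≢a j≢b → off (suc j) (j≢a ∘ FP.suc-injective) (j≢b ∘ FP.suc-injective))))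
      (ℤP.+-identityˡ _)

-- 𝒬 is a bijection between s-cores and s-sets; what the theorem needs is
--  * Σ 𝒬(ν) = C(s,2) for every s-core ν, and
--  * every vector q of residue representatives with Σ q = C(s,2) is 𝒬 of an s-core.
-- Both come from shifting q by n = M·s into ℕ and counting the list D of
-- k < 2n with k - n below q: Σ q = C(s,2) exactly when |D| = n, and for an
-- s-core D is the list of shifted beta numbers, which has n elements.
module SSets (s : ℕ) .{{_ : NonZero s}} where

  open import Data.Nat as ℕ using (ℕ; _≤_)
  import Data.Nat.Properties as NP
  open import Data.Nat.DivMod using (_mod_; _%_; m<n⇒m%n≡m)
  open import Data.Nat.Combinatorics using (_C_)
  open import Data.Integer as ℤ using (ℤ; +_; _+_; _*_; _-_; -_; _<_; ∣_∣)
  import Data.Integer.Properties as ℤP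
  open import Data.Integer.Tactic.RingSolver using (solve-∀)
  open import Data.Fin as F using (Fin; toℕ)
  import Data.Fin.Properties as FP
  open import Data.List using (length)
  open import Data.List.Membership.Propositional using (_∈_)
  open import Data.Product using (Σ; _,_; proj₁; proj₂)
  open import Data.Sum using (inj₁; inj₂)
  open import Relation.Nullary using (yes; no)
  open import Relation.Binary.PropositionalEquality
  import Algebra.Properties.Semiring.Sum NP.+-*-semiring as ℕΣ
  open IntegerFacts
  open import Algebra.Properties.AbelianGroup ℤP.+-0-abelianGroup using (∙-cancelʳ)
  open Residues s
  open DescribedBeta s
  open BetaLists
  open CountBelow s
  open IntegerSums using (sum; sum-cong-≗; ∑-distrib-+; sum-const; sum-pos)

  term≤sum : ∀ {n} (g : Fin n → ℕ) c → g c ≤ ℕΣ.sum g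
  term≤sum g F.zero    = NP.m≤m+n (g F.zero) _
  term≤sum g (F.suc c) = NP.≤-trans (term≤sum (λ c → g (F.suc c)) c) (NP.m≤n+m _ (g F.zero))

  module Shift (q : Fin s → ℤ) (q-≈ : ∀ c → q c ≈ + toℕ c) (ℓ : ℕ) where

    -- M·s bounds every |q c| and also ℓ.
    M : ℕ
    M = ℓ ℕ.+ ℕΣ.sum (λ c → ∣ q c ∣)

    n : ℕ
    n = M ℕ.* s

    ℓ≤n : ℓ ≤ n
    ℓ≤n = NP.≤-trans (NP.m≤m+n ℓ _) (NP.m≤m*n M s)

    |q|≤n : ∀ c → ∣ q c ∣ ≤ n
    |q|≤n c = NP.≤-trans (NP.≤-trans (term≤sum (λ c → ∣ q c ∣) c) (NP.m≤n+m _ ℓ)) (NP.m≤m*n M s)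

    -n≤q : ∀ c → - (+ n) ℤ.≤ q c
    -n≤q c = proj₁ (abs-bounds (q c) (|q|≤n c))

    q≤n : ∀ c → q c ℤ.≤ + n
    q≤n c = proj₂ (abs-bounds (q c) (|q|≤n c))

    Q : Fin s → ℕ
    Q c = ∣ q c + + n ∣

    Q≡ : ∀ c → + Q c ≡ q c + + n
    Q≡ c = ℤP.0≤i⇒+∣i∣≡i (subst (ℤ._≤ q c + + n) (ℤP.+-inverseˡ (+ n)) (ℤP.+-monoˡ-≤ (+ n) (-n≤q c)))

    n≈0 : + n ≈ + 0
    n≈0 = ≈-subst (+-multiple (+ 0) (+ M)) (trans (ℤP.+-identityˡ _) (sym (ℤP.pos-* M s))) refl

    shift-≈ : ∀ k → + k - + n ≈ + toℕ (k mod s)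
    shift-≈ k = ≈-trans (≈-subst (+-multiple (+ k) (- + M)) (cong (λ w → + k + w) (sym neg-n)) refl) (≈-sym (mod-≈ k))
      where
        neg-n : - (+ n) ≡ (- + M) * + s
        neg-n = trans (cong -_ (ℤP.pos-* M s)) (ℤP.neg-distribˡ-* (+ M) (+ s))

    Q-residue : ∀ c → Q c % s ≡ toℕ c
    Q-residue c = trans (≈⇒%≡ Q≈c) (m<n⇒m%n≡m (FP.toℕ<n c))
      where Q≈c : + Q c ≈ + toℕ c
            Q≈c = ≈-subst (≈-+ (q-≈ c) n≈0) (sym (Q≡ c)) (ℤP.+-identityʳ (+ toℕ c))

    Q≤ : ∀ c → Q c ≤ (M ℕ.+ M) ℕ.* s
    Q≤ c = subst (Q c ≤_) (sym (NP.*-distribʳ-+ s M M))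
             (ℤP.drop‿+≤+ (subst₂ ℤ._≤_ (sym (Q≡ c)) (sym (ℤP.pos-+ n n)) (ℤP.+-monoˡ-≤ (+ n) (q≤n c))))

    open Count Q (M ℕ.+ M) Q-residue Q≤ public

    residue-shift : ∀ k → residue (+ k - + n) ≡ k mod s
    residue-shift k = residue-unique (+ k - + n) (k mod s) (shift-≈ k)

    ∈D⇒below : ∀ k → k ∈ D → + k - + n < q (residue (+ k - + n))
    ∈D⇒below k k∈D = subst (λ c → + k - + n < q c) (sym (residue-shift k))
      (<-by-diff (ℤ.+<+ (∈D⇒below-Q k k∈D)) (trans (cong (_- + k) (Q≡ (k mod s))) (shift (q (k mod s)) (+ n) (+ k))))
      where shift : ∀ q n k → (q + n) - k ≡ q - (k - n)
            shift = solve-∀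

    below⇒∈D : ∀ k → + k - + n < q (residue (+ k - + n)) → k ∈ D
    below⇒∈D k below = below-Q⇒∈D k (ℤP.drop‿+<+ (<-by-diff (subst (λ c → + k - + n < q c) (residue-shift k) below)
      (trans (unshift (q (k mod s)) (+ n) (+ k)) (cong (_- + k) (sym (Q≡ (k mod s)))))))
      where unshift : ∀ q n k → q - (k - n) ≡ (q + n) - k
            unshift = solve-∀

    sum-relation : + (s C 2 ℕ.+ ℕΣ.sum j ℕ.* s) ≡ sum q + + (n ℕ.* s)
    sum-relation = begin
      + (s C 2 ℕ.+ ℕΣ.sum j ℕ.* s)  ≡⟨ cong +_ (sym sum-Q) ⟩
      + ℕΣ.sum Q                    ≡⟨ sym (sum-pos s Q) ⟩
      sum (λ c → + Q c)             ≡⟨ sum-cong-≗ Q≡ ⟩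
      sum (λ c → q c + + n)         ≡⟨ ∑-distrib-+ q (λ _ → + n) ⟩
      sum q + sum (λ (_ : Fin s) → + n) ≡⟨ cong (λ w → sum q + w) (trans (sum-const s (+ n)) (sym (ℤP.pos-* s n))) ⟩
      sum q + + (s ℕ.* n)           ≡⟨ cong (λ w → sum q + + w) (NP.*-comm s n) ⟩
      sum q + + (n ℕ.* s)           ∎
      where open ≡-Reasoning

    sum≡C⇒length-D≡n : sum q ≡ + (s C 2) → length D ≡ n
    sum≡C⇒length-D≡n sum≡C = trans length-D (NP.*-cancelʳ-≡ (ℕΣ.sum j) n s (NP.+-cancelˡ-≡ (s C 2) _ _
      (ℤP.+-injective (trans sum-relation (trans (cong (_+ + (n ℕ.* s)) sum≡C) (sym (ℤP.pos-+ (s C 2) (n ℕ.* s))))))))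

    length-D≡n⇒sum≡C : length D ≡ n → sum q ≡ + (s C 2)
    length-D≡n⇒sum≡C |D|≡n = ∙-cancelʳ (+ (n ℕ.* s)) (sum q) (+ (s C 2))
      (trans (sym sum-relation) (trans (cong (λ m → + (s C 2 ℕ.+ m ℕ.* s)) (trans (sym length-D) |D|≡n))
        (ℤP.pos-+ (s C 2) (n ℕ.* s))))

  -- Σ 𝒬(ν) = C(s,2): for an s-core, D is the list of shifted beta numbers.
  sum-of-𝒬 : ∀ {ν q} → IsQ s ν q → IsCore s ν → sum q ≡ + (s C 2)
  sum-of-𝒬 {ν} {q} isQ core = length-D≡n⇒sum≡C (trans (same-members⇒same-length D-decreasing
    (shiftedBeta-decreasing ν n) D⇒β β⇒D) (length-shiftedBeta ν n))
    where
      open Shift q (q-≈ {ν} isQ core) (length (parts ν))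
      described = core⇒described {ν} isQ core
      D⇒β : ∀ k → k ∈ D → k ∈ shiftedBeta ν n
      D⇒β k k∈D = beta⇒shiftedBeta ν n ℓ≤n k (proj₂ (described _) (∈D⇒below k k∈D))
      β⇒D : ∀ k → k ∈ shiftedBeta ν n → k ∈ D
      β⇒D k k∈β = below⇒∈D k (proj₁ (described _) (shiftedBeta⇒beta ν n k k∈β))

  -- Every s-set is 𝒬 of an s-core: the partition with shifted beta list D.
  module Realise (q : Fin s → ℤ) (q-≈ : ∀ c → q c ≈ + toℕ c) (sum≡C : sum q ≡ + (s C 2)) where
    open Shift q q-≈ 0

    |D|≡n : length D ≡ n
    |D|≡n = sum≡C⇒length-D≡n sum≡C

    ν : Partition
    ν = fromBeta D D-decreasing

    describes : Describes q ν
    describes z = beta⇒below , below⇒beta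
      where
        beta⇒below : InBeta ν z → z < q (residue z)
        beta⇒below inB with beta-fromBeta⇒ D D-decreasing z inB
        ... | inj₁ (k , k∈D , z≡) = subst (λ w → w < q (residue w)) (sym (trans z≡ (cong (λ m → + k - + m) |D|≡n))) (∈D⇒below k k∈D)
        ... | inj₂ z<-|D| = ℤP.<-≤-trans (subst (λ m → z < - (+ m)) |D|≡n z<-|D|) (-n≤q (residue z))
        below⇒beta : z < q (residue z) → InBeta ν z
        below⇒beta z<q with z ℤP.<? - (+ n)
        ... | yes z<-n = beta-fromBeta⇐ D D-decreasing z (subst (λ m → z < - (+ m)) (sym |D|≡n) z<-n)
        ... | no z≮-n = subst (InBeta ν) z≡ (beta-fromBeta⇐ᴰ D D-decreasing k (below⇒∈D k (subst (λ w → w < q (residue w)) (sym k-n≡z) z<q)))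
          where
            k : ℕ
            k = ∣ z + + n ∣
            k≡ : + k ≡ z + + n
            k≡ = ℤP.0≤i⇒+∣i∣≡i (subst (ℤ._≤ z + + n) (ℤP.+-inverseˡ (+ n)) (ℤP.+-monoˡ-≤ (+ n) (ℤP.≮⇒≥ z≮-n)))
            cancel : ∀ z n → (z + n) - n ≡ z
            cancel = solve-∀
            k-n≡z : + k - + n ≡ z
            k-n≡z = trans (cong (_- + n) k≡) (cancel z (+ n))
            z≡ : + k - + length D ≡ z
            z≡ = trans (cong (λ m → + k - + m) |D|≡n) k-n≡z

    core : IsCore s ν
    core = described⇒core {q} {ν} s describes step-bounded
      where
        -- c ≡ d + s forces c = d
        step-bounded : StepBounded s q
        step-bounded c d c≈d+s = subst (λ e → q e ℤ.≤ q d + + s) (sym (≈⇒≡ c≈d)) (ℤP.i≤i+j (q d) (+ s))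
          where
            c≈d : + toℕ c ≈ + toℕ d
            c≈d = ≈-trans c≈d+s (≈-subst (+-multiple (+ toℕ d) (+ 1)) (cong (λ w → + toℕ d + w) (ℤP.*-identityˡ (+ s))) refl)

    isQ : IsQ s ν q
    isQ = described⇒IsQ {q} {ν} q-≈ describes

-- The generator σᵢ of the level-t action exchanges the slots
-- a i ≡ i·t and b i ≡ (i-1)·t:  q'(a i) = q(b i) + t,  q'(b i) = q(a i) - t.
module Generators (s t : ℕ) .{{_ : NonZero s}} where

  open import Data.Nat as ℕ using (ℕ; suc)
  import Data.Nat.Properties as NP
  open import Data.Nat.DivMod using (_mod_; m<n⇒m%n≡m)
  open import Data.Nat.Coprimality using (Coprime; coprime-Bézout)
  open import Data.Nat.GCD using (module Bézout)
  open import Data.Integer using (ℤ; +_; _+_; _*_; _-_; -_)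
  import Data.Integer.Properties as ℤP
  open import Data.Integer.Tactic.RingSolver using (solve-∀)
  open import Data.Fin as F using (Fin; toℕ)
  open import Data.Product using (Σ; _×_; _,_; proj₁; proj₂)
  open import Data.Empty using (⊥-elim)
  open import Relation.Nullary using (yes; no; Dec)
  open import Relation.Binary.PropositionalEquality
  open Residues s
  open IntegerSums using (sum; sum-difference; sum-two-points)

  a b : Fin s → Fin s
  a i = (toℕ i ℕ.* t) mod s
  b i = ((toℕ i ℕ.+ (s ℕ.∸ 1)) ℕ.* t) mod s

  χσ-at-a : ∀ i f → χσ s t i f (a i) ≡ f (b i) + + t
  χσ-at-a i f with a i F.≟ a i
  ... | yes _ = refl
  ... | no a≢a = ⊥-elim (a≢a refl)

  χσ-at-b : ∀ i f → a i ≢ b i → χσ s t i f (b i) ≡ f (a i) - + t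
  χσ-at-b i f a≢b with b i F.≟ a i | b i F.≟ b i
  ... | yes b≡a | _      = ⊥-elim (a≢b (sym b≡a))
  ... | no _    | yes _  = refl
  ... | no _    | no b≢b = ⊥-elim (b≢b refl)

  χσ-elsewhere : ∀ i f j → j ≢ a i → j ≢ b i → χσ s t i f j ≡ f j
  χσ-elsewhere i f j j≢a j≢b with j F.≟ a i | j F.≟ b i
  ... | yes j≡a | _       = ⊥-elim (j≢a j≡a)
  ... | no _    | yes j≡b = ⊥-elim (j≢b j≡b)
  ... | no _    | no _    = refl

  a-≈ : ∀ i → + toℕ (a i) ≈ + toℕ i * + t
  a-≈ i = ≈-subst (mod-≈ (toℕ i ℕ.* t)) refl (ℤP.pos-* (toℕ i) t)

  b-≈ : ∀ i → + toℕ (b i) ≈ + toℕ i * + t - + t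
  b-≈ i = ≈-trans (mod-≈ _) (≈-subst (+-multiple (+ toℕ i * + t - + t) (+ t)) (sym (expand s (toℕ i))) refl)
    where
      expand : ∀ s i .{{_ : NonZero s}} → + ((i ℕ.+ (s ℕ.∸ 1)) ℕ.* t) ≡ (+ i * + t - + t) + + t * + s
      expand (suc s) i = trans (ℤP.pos-* (i ℕ.+ s) t) (trans (cong (_* + t) (ℤP.pos-+ i s)) (ring (+ i) (+ s) (+ t)))
        where ring : ∀ i s t → (i + s) * t ≡ (i * t - t) + t * (+ 1 + s)
              ring = solve-∀

  inverse : Coprime s t → Σ ℤ λ u → u * + t ≈ + 1
  inverse cop with coprime-Bézout cop
  ... | Bézout.+- x y eq = - + y , ⟪ - + x , rearrange (+ y) (+ t) (+ x) (+ s) (lift eq) ⟫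
    where
      lift : 1 ℕ.+ y ℕ.* t ≡ x ℕ.* s → + 1 + + y * + t ≡ + x * + s
      lift e = trans (cong (λ w → + 1 + w) (sym (ℤP.pos-* y t)))
                 (trans (sym (ℤP.pos-+ 1 (y ℕ.* t))) (trans (cong +_ e) (ℤP.pos-* x s)))
      rearrange : ∀ y t x s → + 1 + y * t ≡ x * s → (- y) * t - + 1 ≡ (- x) * s
      rearrange y t x s e = trans (l₁ y t) (trans (cong -_ e) (l₂ x s))
        where l₁ : ∀ y t → (- y) * t - + 1 ≡ - (+ 1 + y * t)
              l₁ = solve-∀
              l₂ : ∀ x s → - (x * s) ≡ (- x) * s
              l₂ = solve-∀
  ... | Bézout.-+ x y eq = + y , ⟪ + x , rearrange (+ y) (+ t) (+ x) (+ s) (lift eq) ⟫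
    where
      lift : 1 ℕ.+ x ℕ.* s ≡ y ℕ.* t → + 1 + + x * + s ≡ + y * + t
      lift e = trans (cong (λ w → + 1 + w) (sym (ℤP.pos-* x s)))
                 (trans (sym (ℤP.pos-+ 1 (x ℕ.* s))) (trans (cong +_ e) (ℤP.pos-* y t)))
      rearrange : ∀ y t x s → + 1 + x * s ≡ y * t → y * t - + 1 ≡ x * s
      rearrange y t x s e = trans (cong (_- + 1) (sym e)) (l x s)
        where l : ∀ x s → (+ 1 + x * s) - + 1 ≡ x * s
              l = solve-∀

  divide-by-t : Coprime s t → ∀ x → Σ (Fin s) λ m → + toℕ m * + t ≈ x
  divide-by-t cop x = m , ≈-trans (≈-*ʳ (+ t) (≈-sym (residue-≈ (u * x))))
                                  (≈-subst (≈-*ʳ x (proj₂ (inverse cop))) (swap u (+ t) x) (ℤP.*-identityˡ x))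
    where
      u : ℤ
      u = proj₁ (inverse cop)
      m : Fin s
      m = residue (u * x)
      swap : ∀ u t x → u * t * x ≡ u * x * t
      swap = solve-∀

  -- For s > 1 the two slots of σᵢ differ (otherwise t ≡ 0, yet t is invertible).
  a≢b : 1 ℕ.< s → Coprime s t → ∀ i → a i ≢ b i
  a≢b 1<s cop i a≡b = NP.0≢1+n (trans (sym (m<n⇒m%n≡m (NP.<-trans (NP.n<1+n 0) 1<s)))
                        (trans (≈⇒%≡ 0≈1) (m<n⇒m%n≡m 1<s)))
    where
      u it : ℤ
      u = proj₁ (inverse cop)
      it = + toℕ i * + t
      t≈0 : + t ≈ + 0
      t≈0 = ≈-subst (≈-+ (≈-trans (≈-sym (a-≈ i)) (≈-trans (≈-subst ≈-refl refl (cong (λ c → + toℕ c) a≡b)) (b-≈ i)))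
                         (≈-refl { - (it - + t)}))
                    (l₁ it (+ t)) (l₂ it (+ t))
        where l₁ : ∀ x t → x + - (x - t) ≡ t
              l₁ = solve-∀
              l₂ : ∀ x t → (x - t) + - (x - t) ≡ + 0
              l₂ = solve-∀
      0≈1 : + 0 ≈ + 1
      0≈1 = ≈-trans (≈-subst (≈-*ʳ u (≈-sym t≈0)) (ℤP.*-zeroˡ u) (ℤP.*-comm (+ t) u)) (proj₂ (inverse cop))

  slots-of : Coprime s t → ∀ c d → + toℕ c ≈ + toℕ d + + t → Σ (Fin s) λ i → a i ≡ c × b i ≡ d
  slots-of cop c d c≈d+t = i , ≈⇒≡ (≈-trans (a-≈ i) (≈-trans it≈ (≈-sym c≈d+t)))
                             , ≈⇒≡ (≈-trans (b-≈ i) (≈-subst (≈-+ it≈ (≈-refl { - + t})) refl (cancel (+ toℕ d) (+ t))))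
    where
      i : Fin s
      i = proj₁ (divide-by-t cop (+ toℕ d + + t))
      it≈ : + toℕ i * + t ≈ + toℕ d + + t
      it≈ = proj₂ (divide-by-t cop (+ toℕ d + + t))
      cancel : ∀ d t → (d + t) - t ≡ d
      cancel = solve-∀

  module Step (1<s : 1 ℕ.< s) (cop : Coprime s t) (q : Fin s → ℤ) (q-≈ : ∀ c → q c ≈ + toℕ c) (i : Fin s) where

    q′ : Fin s → ℤ
    q′ = χσ s t i q

    private
      a≢bᵢ : a i ≢ b i
      a≢bᵢ = a≢b 1<s cop i

    -- q(b i) + t ≡ (i-1)t + t = it ≡ a i   and   q(a i) - t ≡ it - t ≡ b i
    private
      cancel : ∀ x t → (x - t) + t ≡ x
      cancel = solve-∀

      at-a : q′ (a i) ≈ + toℕ (a i)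
      at-a = ≈-subst (≈-trans (≈-subst (≈-+ (≈-trans (q-≈ (b i)) (b-≈ i)) (≈-refl {+ t})) refl (cancel _ (+ t)))
                              (≈-sym (a-≈ i)))
                     (sym (χσ-at-a i q)) refl

      at-b : q′ (b i) ≈ + toℕ (b i)
      at-b = ≈-subst (≈-trans (≈-+ (≈-trans (q-≈ (a i)) (a-≈ i)) (≈-refl { - + t})) (≈-sym (b-≈ i)))
                     (sym (χσ-at-b i q a≢bᵢ)) refl

    q′-≈ : ∀ c → q′ c ≈ + toℕ c
    q′-≈ c = by-cases (c F.≟ a i) (c F.≟ b i)
      where
        by-cases : Dec (c ≡ a i) → Dec (c ≡ b i) → q′ c ≈ + toℕ c
        by-cases (yes c≡a) _         = subst (λ c → q′ c ≈ + toℕ c) (sym c≡a) at-a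
        by-cases (no _)    (yes c≡b) = subst (λ c → q′ c ≈ + toℕ c) (sym c≡b) at-b
        by-cases (no c≢a)  (no c≢b)  = ≈-subst (q-≈ c) (sym (χσ-elsewhere i q c c≢a c≢b)) refl

    private
      two-slots : (F : ℤ → ℤ) → sum (λ j → F (q′ j)) ≡ sum (λ j → F (q j)) + ((F (q′ (a i)) - F (q (a i))) + (F (q′ (b i)) - F (q (b i))))
      two-slots F = trans (sum-difference s (λ j → F (q j)) (λ j → F (q′ j)))
        (cong (λ w → sum (λ j → F (q j)) + w) (sum-two-points s _ (a i) (b i) a≢bᵢ unchanged))
        where unchanged : ∀ j → j ≢ a i → j ≢ b i → F (q′ j) - F (q j) ≡ + 0
              unchanged j j≢a j≢b = trans (cong (λ x → F x - F (q j)) (χσ-elsewhere i q j j≢a j≢b)) (ℤP.+-inverseʳ (F (q j)))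

    sum-preserved : sum q′ ≡ sum q
    sum-preserved = trans (two-slots (λ x → x))
      (trans (cong₂ (λ x y → sum q + ((x - q (a i)) + (y - q (b i)))) (χσ-at-a i q) (χσ-at-b i q a≢bᵢ))
        (trans (cong (λ w → sum q + w) (ring (q (a i)) (q (b i)) (+ t))) (ℤP.+-identityʳ (sum q))))
      where ring : ∀ x y t → ((y + t) - x) + ((x - t) - y) ≡ + 0
            ring = solve-∀

    sumSq-change : sum (λ j → q′ j * q′ j) ≡ sum (λ j → q j * q j) + + 2 * + t * ((q (b i) - q (a i)) + + t)
    sumSq-change = trans (two-slots (λ x → x * x))
      (cong (λ w → sum (λ j → q j * q j) + w) (trans (cong₂ (λ x y → (x * x - q (a i) * q (a i)) + (y * y - q (b i) * q (b i)))
        (χσ-at-a i q) (χσ-at-b i q a≢bᵢ)) (ring (q (a i)) (q (b i)) (+ t))))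
      where ring : ∀ x y t → ((y + t) * (y + t) - x * x) + ((x - t) * (x - t) - y * y) ≡ + 2 * t * ((y - x) + t)
            ring = solve-∀

-- If q(c) > q(d) + t for classes
-- c ≡ d + t, the generator σᵢ with slots (c , d) lowers Σ q² by
-- 2t(q(c) - q(d) - t) > 0 while producing another s-set, hence (by
-- realisation) another s-core in the orbit.
module Minimality (s t : ℕ) .{{_ : NonZero s}} where

  open import Data.Nat as ℕ using (ℕ; suc)
  open import Data.Nat.Coprimality using (Coprime)
  open import Data.Nat.Combinatorics using (_C_)
  open import Data.Integer as ℤ using (ℤ; +_; -[1+_]; _+_; _*_; _-_; _≤_; _<_; 0ℤ)
  import Data.Integer.Properties as ℤP
  open import Data.Integer.Tactic.RingSolver using (solve-∀)
  open import Data.Fin using (Fin; toℕ)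
  open import Data.List using (List; []; _∷_)
  open import Data.Product using (Σ; _×_; proj₁; proj₂)
  open import Data.Empty using (⊥)
  open import Relation.Binary.PropositionalEquality
  open IntegerFacts
  open Residues s
  open DescribedBeta s using (StepBounded)
  open SSets s using (module Realise)
  open Generators s t
  open IntegerSums using (sum; sumSq≡sum)

  MinimalInOrbit : (Fin s → ℤ) → Set
  MinimalInOrbit q = ∀ (ν′ : Partition) → IsCore s ν′ → (q′ : Fin s → ℤ) → IsQ s ν′ q′ →
    (w : List (Fin s)) → (∀ j → χ s t w q j ≡ q′ j) → sumSq s q ≤ sumSq s q′

  negative-product : ∀ t x → 0 ℕ.< t → x < 0ℤ → + 2 * + t * x < 0ℤ
  negative-product (suc t) (+ n)    _ (ℤ.+<+ ())
  negative-product (suc t) -[1+ n ] _ _ = ℤ.-<+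

  minimal⇒slots-close : 1 ℕ.< s → 0 ℕ.< t → Coprime s t → ∀ {q} → (∀ c → q c ≈ + toℕ c) →
    sum q ≡ + (s C 2) → MinimalInOrbit q → ∀ i → q (a i) ≤ q (b i) + + t
  minimal⇒slots-close 1<s 0<t cop {q} q-≈ sum≡C minimal i = ℤP.≮⇒≥ too-far
    where
      open Generators.Step s t 1<s cop q q-≈ i
      open Realise q′ q′-≈ (trans sum-preserved sum≡C) using (ν; core; isQ)

      too-far : q (b i) + + t < q (a i) → ⊥
      too-far far = ℤP.<⇒≱ smaller (subst₂ _≤_ (sumSq≡sum s q) (trans (sumSq≡sum s q′) sumSq-change)
                                               (minimal ν core q′ isQ (i ∷ []) (λ _ → refl)))
        where
          X : ℤ
          X = sum (λ j → q j * q j)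
          rearrange : ∀ x y t → x - (y + t) ≡ 0ℤ - ((y - x) + t)
          rearrange = solve-∀
          negative : (q (b i) - q (a i)) + + t < 0ℤ
          negative = <-by-diff far (rearrange (q (a i)) (q (b i)) (+ t))
          smaller : X + + 2 * + t * ((q (b i) - q (a i)) + + t) < X
          smaller = ℤP.<-≤-trans (ℤP.+-monoʳ-< X (negative-product t _ 0<t negative)) (ℤP.≤-reflexive (ℤP.+-identityʳ X))

  -- Every pair c ≡ d + t is a pair of slots, so a minimiser is t-step-bounded.
  minimal⇒step-bounded : 1 ℕ.< s → 0 ℕ.< t → Coprime s t → ∀ {q} → (∀ c → q c ≈ + toℕ c) →
    sum q ≡ + (s C 2) → MinimalInOrbit q → StepBounded t q
  minimal⇒step-bounded 1<s 0<t cop {q} q-≈ sum≡C minimal c d c≈d+t =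
    subst₂ (λ c d → q c ≤ q d + + t) a≡c b≡d (minimal⇒slots-close 1<s 0<t cop q-≈ sum≡C minimal i)
    where
      slots : Σ (Fin s) λ i → a i ≡ c × b i ≡ d
      slots = slots-of cop c d c≈d+t
      i : Fin s
      i = proj₁ slots
      a≡c : a i ≡ c
      a≡c = proj₁ (proj₂ slots)
      b≡d : b i ≡ d
      b≡d = proj₂ (proj₂ slots)

module SortedLists where

  open import Data.Integer using (ℤ; _≤_; _<_)
  import Data.Integer.Properties as ℤP
  open import Data.List using (List; []; _∷_)
  open import Data.List.Relation.Unary.All as All using (All)
  open import Data.List.Relation.Unary.Any using (here; there)
  open import Data.List.Membership.Propositional using (_∈_)
  open import Data.List.Relation.Unary.Linked using (Linked; []; [-]; _∷_)
  open import Data.List.Relation.Unary.Linked.Properties using (Linked⇒All)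
  open import Data.List.Relation.Unary.Unique.Propositional using (Unique; []; _∷_)
  open import Data.List.Relation.Unary.AllPairs using (_∷_)
  open import Data.Product using (_×_; _,_)
  open import Data.Empty using (⊥-elim)
  open import Relation.Binary.PropositionalEquality

  Consecutive : List ℤ → ℤ → ℤ → Set
  Consecutive l a b = a ∈ l × b ∈ l × a < b × (∀ c → c ∈ l → a < c → b ≤ c)

  consecutive-pairs : ∀ {R : ℤ → ℤ → Set} {l} → Linked _≤_ l → Unique l →
    (∀ a b → Consecutive l a b → R a b) → Linked R l
  consecutive-pairs [] _ H = []
  consecutive-pairs [-] _ H = [-]
  consecutive-pairs {R} {x ∷ y ∷ rest} (x≤y ∷ sorted) ((x≢y All.∷ _) ∷ unique) H =
    H x y (here refl , there (here refl) , x<y , y-next) ∷ consecutive-pairs sorted unique H′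
    where
      x<y : x < y
      x<y = ℤP.≤∧≢⇒< x≤y x≢y
      x≤all : ∀ {c} → c ∈ y ∷ rest → x ≤ c
      x≤all = All.lookup (Linked⇒All ℤP.≤-trans x≤y sorted)
      y-next : ∀ c → c ∈ x ∷ y ∷ rest → x < c → y ≤ c
      y-next c (here refl)         x<c = ⊥-elim (ℤP.<-irrefl refl x<c)
      y-next c (there (here refl)) _   = ℤP.≤-refl
      y-next c (there (there c∈))  _   = All.lookup (Linked⇒All ℤP.≤-trans ℤP.≤-refl sorted) (there c∈)
      H′ : ∀ a b → Consecutive (y ∷ rest) a b → R a b
      H′ a b (a∈ , b∈ , a<b , b-next) = H a b (there a∈ , there b∈ , a<b , b-next′)
        where
          b-next′ : ∀ c → c ∈ x ∷ y ∷ rest → a < c → b ≤ c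
          b-next′ c (here refl) a<x = ⊥-elim (ℤP.<⇒≱ a<x (x≤all a∈))
          b-next′ c (there c∈)  a<c = b-next c c∈ a<c

-- Starting from the class d₀ of
-- a non-maximal element, the classes d₀, d₀+t, d₀+2t, … run through all of
-- Fin s (t is invertible mod s), and each step raises q by at most t; so
-- if no element lay in (q(d₀), q(d₀)+t], no element at all could exceed q(d₀).
-- Hence consecutive elements of p = sort q differ by at most t.
module Rhomboid (s t : ℕ) .{{_ : NonZero s}} where

  open import Data.Nat using (ℕ; zero; suc)
  open import Data.Nat.Combinatorics using (_C_)
  open import Data.Nat.Coprimality using (Coprime)
  open import Data.Integer using (ℤ; +_; _+_; _*_; _-_; _≤_; _<_)
  import Data.Integer.Properties as ℤP
  open import Data.Integer.Tactic.RingSolver using (solve-∀)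
  open import Data.Fin using (Fin; toℕ)
  import Data.Fin.Properties as FP
  open import Data.List using (length; foldr; tabulate)
  import Data.List.Properties as LP
  open import Data.List.Membership.Propositional.Properties using (∈-tabulate⁺; ∈-tabulate⁻)
  open import Data.List.Relation.Binary.Permutation.Propositional using (_↭_; ↭-sym; ↭⇒↭ₛ)
  open import Data.List.Relation.Binary.Permutation.Propositional.Properties using (∈-resp-↭; ↭-length)
  open import Relation.Binary.PropositionalEquality
  open import Data.List.Relation.Binary.Permutation.Setoid.Properties (setoid ℤ) using (foldr-commMonoid; Unique-resp-↭)
  open import Data.List.Relation.Unary.Unique.Propositional using (Unique)
  import Data.List.Relation.Unary.Unique.Propositional.Properties as Unique
  open import Data.List.Sort ℤP.≤-decTotalOrder using (sort-↭; sort-↗)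
  open import Data.Product using (Σ; _×_; _,_; proj₁; proj₂)
  open import Data.Empty using (⊥-elim)
  open import Relation.Nullary using (yes; no)
  open import Relation.Nullary.Decidable using (_×-dec_)
  open IntegerFacts
  open Residues s
  open DescribedBeta s using (StepBounded)
  open Generators s t using (divide-by-t)
  open IntegerSums using (sum; foldr-tabulate)
  open SortedLists

  module _ (cop : Coprime s t) (q : Fin s → ℤ) (q-≈ : ∀ c → q c ≈ + toℕ c) (bounded : StepBounded t q) where

    next : Fin s → Fin s
    next e = residue (+ toℕ e + + t)

    iterate : ℕ → Fin s → Fin s
    iterate zero    d = d
    iterate (suc m) d = next (iterate m d)

    iterate-≈ : ∀ d m → + toℕ (iterate m d) ≈ + toℕ d + + m * + t
    iterate-≈ d zero    = ≈-subst ≈-refl refl (sym (ℤP.+-identityʳ _))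
    iterate-≈ d (suc m) = ≈-trans (≈-sym (residue-≈ _)) (≈-subst (≈-+ (iterate-≈ d m) (≈-refl {+ t})) refl (step (+ toℕ d) (+ m) (+ t)))
      where step : ∀ d m t → (d + m * t) + t ≡ d + (+ 1 + m) * t
            step = solve-∀

    reach : ∀ d₀ d₁ → Σ ℕ λ m → iterate m d₀ ≡ d₁
    reach d₀ d₁ = toℕ m , ≈⇒≡ (≈-trans (iterate-≈ d₀ (toℕ m)) (≈-subst (≈-+ (≈-refl {+ toℕ d₀}) mt≈) refl (cancel (+ toℕ d₀) (+ toℕ d₁))))
      where
        m : Fin s
        m = proj₁ (divide-by-t cop (+ toℕ d₁ - + toℕ d₀))
        mt≈ : + toℕ m * + t ≈ + toℕ d₁ - + toℕ d₀
        mt≈ = proj₂ (divide-by-t cop (+ toℕ d₁ - + toℕ d₀))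
        cancel : ∀ d₀ d₁ → d₀ + (d₁ - d₀) ≡ d₁
        cancel = solve-∀

    next-value : ∀ d₀ d₁ → q d₀ < q d₁ → Σ (Fin s) λ c → q d₀ < q c × q c ≤ q d₀ + + t
    next-value d₀ d₁ q₀<q₁ with FP.any? (λ c → (q d₀ ℤP.<? q c) ×-dec (q c ℤP.≤? q d₀ + + t))
    ... | yes found = found
    ... | no none   = ⊥-elim (ℤP.<⇒≱ q₀<q₁ (subst (λ d → q d ≤ q d₀) (proj₂ (reach d₀ d₁)) (all-below (proj₁ (reach d₀ d₁)))))
      where
        all-below : ∀ m → q (iterate m d₀) ≤ q d₀
        all-below zero    = ℤP.≤-refl
        all-below (suc m) = ℤP.≮⇒≥ λ above → none (next (iterate m d₀) , above ,
          ℤP.≤-trans (bounded _ _ (≈-sym (residue-≈ _))) (ℤP.+-monoˡ-≤ (+ t) (all-below m)))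

    q-injective : ∀ {i j} → q i ≡ q j → i ≡ j
    q-injective {i} {j} qᵢ≡qⱼ = ≈⇒≡ (≈-trans (≈-sym (q-≈ i)) (≈-subst (q-≈ j) (sym qᵢ≡qⱼ) refl))

    rhomboid : sum q ≡ + (s C 2) → InRhomboid s t (point s q)
    rhomboid sum≡C = length≡s , sum-point , consecutive-pairs (sort-↗ (tabulate q)) unique close
      where
        perm : point s q ↭ tabulate q
        perm = sort-↭ (tabulate q)
        length≡s : length (point s q) ≡ s
        length≡s = trans (↭-length perm) (LP.length-tabulate q)
        sum-point : foldr _+_ (+ 0) (point s q) ≡ + (s C 2)
        sum-point = trans (foldr-commMonoid ℤP.+-0-isCommutativeMonoid (↭⇒↭ₛ perm)) (trans (foldr-tabulate s q) sum≡C)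
        unique : Unique (point s q)
        unique = Unique-resp-↭ (↭⇒↭ₛ (↭-sym perm)) (Unique.tabulate⁺ q-injective)
        close : ∀ x y → Consecutive (point s q) x y → (+ 1 ≤ y - x) × (y - x ≤ + t)
        close x y (x∈ , y∈ , x<y , y-next) with ∈-tabulate⁻ (∈-resp-↭ perm x∈) | ∈-tabulate⁻ (∈-resp-↭ perm y∈)
        ... | d₀ , refl | d₁ , refl with next-value d₀ d₁ x<y
        ... | c , q₀<qc , qc≤ = ≤-by-diff (ℤP.i<j⇒suc[i]≤j x<y) (step (q d₀) (q d₁))
                              , ≤-by-diff (ℤP.≤-trans (y-next (q c) (∈-resp-↭ (↭-sym perm) (∈-tabulate⁺ c)) q₀<qc) qc≤)
                                          (flip (q d₀) (q d₁) (+ t))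
          where
            step : ∀ x y → y - (+ 1 + x) ≡ (y - x) - + 1
            step = solve-∀
            flip : ∀ x y t → (x + t) - y ≡ t - (y - x)
            flip = solve-∀

open import Data.Nat using (ℕ; NonZero; _<_; _>_)
open import Data.Nat.Coprimality using (Coprime)
open import Data.Nat.Combinatorics using (_C_)
open import Data.Integer using (ℤ; +_) renaming (_≤_ to _≤ℤ_)
open import Data.Fin using (Fin; toℕ)
open import Data.List using (List)
open import Data.Product using (_×_; _,_)
open import Relation.Binary.PropositionalEquality using (_≡_)

proposition4p3 : (s t : ℕ) .{{_ : NonZero s}} → 1 < s → 0 < t → Coprime s t →
    (ν : Partition) → IsCore s ν → (q : Fin s → ℤ) → IsQ s ν q →
    (∀ (ν′ : Partition) → IsCore s ν′ → (q′ : Fin s → ℤ) → IsQ s ν′ q′ →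
      (w : List (Fin s)) → (∀ j → χ s t w q j ≡ q′ j) →
      sumSq s q ≤ℤ sumSq s q′) →
    InRhomboid s t (point s q) × IsCore t ν
proposition4p3 s t 1<s 0<t cop ν core q isQ minimal =
  Rhomboid.rhomboid s t cop q q-≈ step-bounded sum≡C , DescribedBeta.described⇒core s {q} {ν} t described step-bounded
  where
    q-≈ : ∀ c → Residues._≈_ s (q c) (+ toℕ c)
    q-≈ = DescribedBeta.q-≈ s {ν} isQ core
    described : DescribedBeta.Describes s q ν
    described = DescribedBeta.core⇒described s {ν} isQ core
    sum≡C : IntegerSums.sum q ≡ + (s C 2)
    sum≡C = SSets.sum-of-𝒬 s {ν} isQ core
    step-bounded : DescribedBeta.StepBounded s t q
    step-bounded = Minimality.minimal⇒step-bounded s t 1<s 0<t cop q-≈ sum≡C minimal
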